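{- Let $n$ be a positive integer, $q,k$ positive integers with $q>k$, and $\alpha,\alpha',\gamma,\gamma',\delta\in(0,1)$, $\delta'\in(0,\tfrac1n)$. Let $G$ be an edge-ordered complete graph whose edges are colored with colors $1,\dots,q$. If $G_{\le k}$ is $(\alpha,\gamma,\delta,n)$-sparse and $G_{k+1}$ is $(\alpha',\gamma',\delta')$-sparse (with respect to the complete graph on $n$ vertices), then $G_{\le k+1}$ is $(\alpha\alpha',\gamma\gamma',n^2(\gamma')^{ -2}\delta+\delta',2)$-sparse.
   Context: An edge-ordered graph is a finite simple graph whose edges carry distinct integer labels. For a $q$-colored edge-ordered complete graph $G$, $G_k$ is the edge-ordered subgraph consisting of the edges of color $k$ (with their labels) and $G_{\le k}$ the one consisting of edges of color at most $k$. An interval is a set of consecutive integers. For an edge-ordered graph $G'$, an interval $I$ and disjoint vertex sets $W,W'$, $d_I(W,W')=e_I(W,W')/(|W||W'|)$ where $e_I$ counts edges of $G'$ between $W$ and $W'$ with label in $I$. (Sparse w.r.t. $K_n$:) $G'$ is $(\alpha,\gamma,\delta)$-sparse if for every interval $I$ with $|I|\ge\alpha^{ -1}$, every vertex set $X$ with $|X|\ge\gamma^{ -1}$ and every partition $X=X_1\cup\dots\cup X_n$ with $|X_i|\ge\delta|X|$, there exist an interval $I'\subset I$, indices $i\ne i'$, and $W\subset X_i$, $W'\subset X_{i'}$ with $|I'|\ge\alpha|I|$, $|W|,|W'|\ge\gamma|X|$, $d_{I'}(W,W')<\delta$. For positive reals $\alpha,\gamma,\delta$ and positive integer $t$, $G'$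 is $(\alpha,\gamma,\delta,t)$-sparse if for every interval $I$ with $|I|\ge\alpha^{ -1}$ and every vertex set $X$ with $|X|\ge\gamma^{ -1}$, there exist an interval $I'\subset I$ and pairwise disjoint $W_1,\dots,W_t\subset X$ with $|I'|\ge\alpha|I|$, $|W_i|\ge\gamma|X|$, and $d_{I'}(W_i,W_j)<\delta$ for all $i<j$.
   Formalization: The parameters α, α', γ, γ', δ and δ' range over the rationals instead of the reals, as do the parameters of both sparseness notions. -}

module Defs where

open import Data.Bool using (Bool; true; false; _∧_; not; if_then_else_)
open import Data.Nat as ℕ using (ℕ; zero; suc)
open import Data.Integer as ℤ using (ℤ; +_)
open import Data.Rational as ℚ using (ℚ; 0ℚ; 1ℚ; _<_; _≤_; _*_; _+_; _/_; 1/_; >-nonZero)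
open import Data.Fin as Fin using (Fin)
open import Data.Fin.Subset using (Subset; _∈_; ∣_∣)
open import Data.Vec using (lookup)
open import Data.List using (List; allFin; map)
open import Data.Nat.ListAction using (sum)
open import Data.Product using (Σ; _×_; _,_; ∃; ∃-syntax)
open import Data.Sum using (_⊎_)
open import Data.Empty using (⊥)
open import Relation.Binary.PropositionalEquality using (_≡_; _≢_)
open import Relation.Nullary using (¬_)

ℕ→ℚ : ℕ → ℚ
ℕ→ℚ m = (+ m) / 1

inv : (p : ℚ) → 0ℚ < p → ℚ
inv p h = 1/_ p {{>-nonZero h}}

-- Intervals: sets of consecutive integers {x ∈ ℤ | lo ≤ x ≤ hi}
-- (empty when hi < lo)

record Interval : Set where
  constructor [_,_]
  field
    lo : ℤ
    hi : ℤ
open Interval public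

_∈ᴵ_ : ℤ → Interval → Set
x ∈ᴵ I = (lo I ℤ.≤ x) × (x ℤ.≤ hi I)

inᴵ : ℤ → Interval → Bool
inᴵ x I = (lo I ℤ.≤ᵇ x) ∧ (x ℤ.≤ᵇ hi I)

size : Interval → ℕ
size I = ℤ.∣ (ℤ.1ℤ ℤ.+ hi I ℤ.- lo I) ℤ.⊔ ℤ.0ℤ ∣

_⊆ᴵ_ : Interval → Interval → Set
I' ⊆ᴵ I = ∀ x → x ∈ᴵ I' → x ∈ᴵ I

-- Edge-ordered graphs on the vertex set Fin N.
-- edge u v = true iff uv is an edge; label u v is the (integer) label of uv.

record EOGraph (N : ℕ) : Set where
  field
    edge  : Fin N → Fin N → Bool
    label : Fin N → Fin N → ℤ
open EOGraph public

Disjoint : {N : ℕ} → Subset N → Subset N → Set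
Disjoint {N} W W' = ∀ (v : Fin N) → v ∈ W → v ∈ W' → ⊥

-- e_I(W,W'): number of edges between W and W' (W, W' disjoint) with label in I,
-- counted as ordered pairs (u,v) with u ∈ W, v ∈ W'.
eI : {N : ℕ} → EOGraph N → Interval → Subset N → Subset N → ℕ
eI {N} G I W W' =
  sum (map (λ u → sum (map (λ v →
    if lookup W u ∧ lookup W' v ∧ edge G u v ∧ inᴵ (label G u v) I
    then 1 else 0) (allFin N))) (allFin N))

-- d_I(W,W') = e_I(W,W') / (|W| |W'|)   (set to 0 if W or W' is empty)
dI : {N : ℕ} → EOGraph N → Interval → Subset N → Subset N → ℚ
dI G I W W' with ∣ W ∣ ℕ.* ∣ W' ∣
... | zero  = 0ℚ
... | suc m = (+ eI G I W W') / suc m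

SparseK : {N : ℕ} → EOGraph N → (n : ℕ) → (α γ δ : ℚ) → 0ℚ < α → 0ℚ < γ → Set
SparseK {N} G n α γ δ α>0 γ>0 =
  ∀ (I : Interval) → inv α α>0 ≤ ℕ→ℚ (size I) →
  ∀ (X : Subset N) → inv γ γ>0 ≤ ℕ→ℚ ∣ X ∣ →
  ∀ (P : Fin n → Subset N) →
    -- P is a partition of X into X_1, ..., X_n
    (∀ i j → i ≢ j → Disjoint (P i) (P j)) →
    (∀ v → v ∈ X → ∃[ i ] v ∈ P i) →
    (∀ i v → v ∈ P i → v ∈ X) →
    (∀ i → δ * ℕ→ℚ ∣ X ∣ ≤ ℕ→ℚ ∣ P i ∣) →
    Σ Interval λ I' → Σ (Fin n) λ i → Σ (Fin n) λ i' → Σ (Subset N) λ W → Σ (Subset N) λ W' →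
      I' ⊆ᴵ I × i ≢ i' × (∀ v → v ∈ W → v ∈ P i) × (∀ v → v ∈ W' → v ∈ P i') ×
      α * ℕ→ℚ (size I) ≤ ℕ→ℚ (size I') ×
      γ * ℕ→ℚ ∣ X ∣ ≤ ℕ→ℚ ∣ W ∣ × γ * ℕ→ℚ ∣ X ∣ ≤ ℕ→ℚ ∣ W' ∣ ×
      dI G I' W W' < δ

Sparse : {N : ℕ} → EOGraph N → (α γ δ : ℚ) → (t : ℕ) → 0ℚ < α → 0ℚ < γ → Set
Sparse {N} G α γ δ t α>0 γ>0 =
  ∀ (I : Interval) → inv α α>0 ≤ ℕ→ℚ (size I) →
  ∀ (X : Subset N) → inv γ γ>0 ≤ ℕ→ℚ ∣ X ∣ →
  Σ Interval λ I' → Σ (Fin t → Subset N) λ W →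
    I' ⊆ᴵ I × α * ℕ→ℚ (size I) ≤ ℕ→ℚ (size I') ×
    (∀ i v → v ∈ W i → v ∈ X) ×
    (∀ i j → i ≢ j → Disjoint (W i) (W j)) ×
    (∀ i → γ * ℕ→ℚ ∣ X ∣ ≤ ℕ→ℚ ∣ W i ∣) ×
    (∀ i j → Fin._<_ i j → dI G I' (W i) (W j) < δ)

record ColoredEOComplete (N q : ℕ) : Set where
  field
    lab : Fin N → Fin N → ℤ
    col : Fin N → Fin N → ℕ
    lab-sym : ∀ u v → lab u v ≡ lab v u
    col-sym : ∀ u v → col u v ≡ col v u
    col-range : ∀ u v → u ≢ v → (1 ℕ.≤ col u v) × (col u v ℕ.≤ q)
    lab-inj : ∀ u v u' v' → u ≢ v → u' ≢ v' → lab u v ≡ lab u' v' →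
              (u ≡ u' × v ≡ v') ⊎ (u ≡ v' × v ≡ u')
open ColoredEOComplete public

colorEq : {N q : ℕ} → ColoredEOComplete N q → ℕ → EOGraph N
colorEq G k = record
  { edge  = λ u v → not (Fin.toℕ u ℕ.≡ᵇ Fin.toℕ v) ∧ (col G u v ℕ.≡ᵇ k)
  ; label = lab G }

colorLe : {N q : ℕ} → ColoredEOComplete N q → ℕ → EOGraph N
colorLe G k = record
  { edge  = λ u v → not (Fin.toℕ u ℕ.≡ᵇ Fin.toℕ v) ∧ (col G u v ℕ.≤ᵇ k)
  ; label = lab G }

{-# OPTIONS --safe #-}

-- Apply the (α,γ,δ,n)-sparseness of G≤k to I and X: it yields I₁ ⊆ I and n disjoint sets
-- W₁,…,Wₙ ⊆ X of size ≥ γ|X| with pairwise G≤k-densities below δ on I₁.  Shrink them, one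
-- vertex at a time, to sets Tᵢ of the common size m = minᵢ |Wᵢ|: deleting from Tᵢ a vertex
-- whose weighted degree towards the other parts is at least the average never increases
-- the sum of all pairwise densities, so every d(Tᵢ,Tⱼ) stays below n²δ.  The Tᵢ partition
-- X' = ⋃ Tᵢ into n parts of size |X'|/n ≥ δ'|X'|, so the sparseness of G_{k+1} with respect
-- to Kₙ gives I₂ ⊆ I₁ and A ⊆ Tᵢ, B ⊆ Tⱼ (i ≠ j) of size ≥ γ'|X'| ≥ γ'm with G_{k+1}-density
-- below δ'.  Their G≤k-density is at most γ'⁻² d(Tᵢ,Tⱼ) ≤ n²γ'⁻²δ, and densities add up
-- over colour classes.

module Submission where

open import Defs
open import Data.Nat as ℕ using (ℕ; NonZero)
open import Data.Rational as ℚ using (ℚ; 0ℚ; 1ℚ; _<_; _*_; _+_; _/_)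
open import Data.Integer using (+_)
open import Data.Product using (_×_)

open import Algebra.Bundles using (CommutativeRing)
open import Data.Bool using (Bool; true; false; T; _∧_; not; if_then_else_)
import Data.Bool.Properties as BoolP
open import Data.Empty using (⊥-elim)
open import Data.Fin as Fin using (Fin; zero; suc; punchIn; toℕ)
import Data.Fin.Properties as FinP
open import Data.Fin.Subset as Subset using (Subset; ∣_∣; _∈_; _⊆_; _-_; _∪_; inside; outside)
import Data.Fin.Subset.Properties as SubsetP
import Data.Integer as ℤ
import Data.Integer.Properties as ℤP
open import Data.List as List using (List; allFin)
open import Data.List.Membership.Propositional using () renaming (_∈_ to _∈ₗ_)
open import Data.List.Membership.Propositional.Properties using (∈-allFin)
import Data.List.Properties as ListP
open import Data.List.Relation.Unary.Any using (here; there)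
import Data.List.Relation.Unary.All as All
import Data.Nat.ListAction as ℕList
import Data.Nat.Properties as ℕP
import Data.List.Extrema ℕP.≤-totalOrder as Extrema
import Data.Product
open import Data.Product using (Σ; ∃-syntax; _,_; proj₂)
open import Data.Rational using (_≤_; toℚᵘ)
import Data.Rational.Properties as ℚP
import Data.Rational.Unnormalised as ℚᵘ
import Data.Rational.Unnormalised.Properties as ℚᵘP
open import Data.Sum using (inj₁; inj₂)
open import Data.Unit using (tt)
open import Data.Vec using ([]; _∷_; lookup; here; there)
import Data.Vec.Properties as VecP
open import Data.Vec.Functional using (foldr; updateAt)
open import Data.Vec.Functional.Properties using (updateAt-updates; updateAt-minimal)
open import Function using (_∘_; Equivalence)
open import Level using (0ℓ)
open import Relation.Binary.Definitions using (tri<; tri≈; tri>)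
open import Relation.Binary.PropositionalEquality
open import Relation.Nullary using (yes; no; _×-dec_)
open import Relation.Nullary.Decidable using (dec⇒maybe)
open import Tactic.RingSolver using (solve-∀)
open import Tactic.RingSolver.Core.AlmostCommutativeRing using (AlmostCommutativeRing; fromCommutativeRing)

open CommutativeRing ℚP.+-*-commutativeRing using (semiring)
open import Algebra.Properties.Semiring.Sum semiring
  using (sum; ∑-comm; ∑-distrib-+; sum-cong-≗; *-distribˡ-sum; sum-remove)

ℚ-ring : AlmostCommutativeRing 0ℓ 0ℓ
ℚ-ring = fromCommutativeRing ℚP.+-*-commutativeRing (λ x → dec⇒maybe (0ℚ ℚP.≟ x))

private
  toℚᵘ-ℕ→ℚ : ∀ a → toℚᵘ (ℕ→ℚ a) ℚᵘ.≃ ℚᵘ.mkℚᵘ (+ a) 0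
  toℚᵘ-ℕ→ℚ a = ℚP.toℚᵘ-fromℚᵘ (ℚᵘ.mkℚᵘ (+ a) 0)

ℕ→ℚ-+ : ∀ a b → ℕ→ℚ (a ℕ.+ b) ≡ ℕ→ℚ a + ℕ→ℚ b
ℕ→ℚ-+ a b = ℚP.toℚᵘ-injective (ℚᵘP.≃-trans (toℚᵘ-ℕ→ℚ (a ℕ.+ b)) (ℚᵘP.≃-sym
  (ℚᵘP.≃-trans (ℚP.toℚᵘ-homo-+ (ℕ→ℚ a) (ℕ→ℚ b))
  (ℚᵘP.≃-trans (ℚᵘP.+-cong (toℚᵘ-ℕ→ℚ a) (toℚᵘ-ℕ→ℚ b)) (ℚᵘ.*≡* (cong (ℤ._* + 1) eq))))))
  where
  eq : + a ℤ.* + 1 ℤ.+ + b ℤ.* + 1 ≡ + (a ℕ.+ b)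
  eq = trans (cong₂ ℤ._+_ (ℤP.*-identityʳ (+ a)) (ℤP.*-identityʳ (+ b))) (sym (ℤP.pos-+ a b))

ℕ→ℚ-* : ∀ a b → ℕ→ℚ (a ℕ.* b) ≡ ℕ→ℚ a * ℕ→ℚ b
ℕ→ℚ-* a b = ℚP.toℚᵘ-injective (ℚᵘP.≃-trans (toℚᵘ-ℕ→ℚ (a ℕ.* b)) (ℚᵘP.≃-sym
  (ℚᵘP.≃-trans (ℚP.toℚᵘ-homo-* (ℕ→ℚ a) (ℕ→ℚ b))
  (ℚᵘP.≃-trans (ℚᵘP.*-cong (toℚᵘ-ℕ→ℚ a) (toℚᵘ-ℕ→ℚ b))
  (ℚᵘ.*≡* (cong (ℤ._* + 1) (sym (ℤP.pos-* a b))))))))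

ℕ→ℚ-suc-* : ∀ a c → ℕ→ℚ (ℕ.suc a) * c ≡ c + ℕ→ℚ a * c
ℕ→ℚ-suc-* a c = trans (cong (_* c) (ℕ→ℚ-+ 1 a))
  (trans (ℚP.*-distribʳ-+ c 1ℚ (ℕ→ℚ a)) (cong (_+ ℕ→ℚ a * c) (ℚP.*-identityˡ c)))

ℕ→ℚ-mono-≤ : ∀ {a b} → a ℕ.≤ b → ℕ→ℚ a ≤ ℕ→ℚ b
ℕ→ℚ-mono-≤ {a} {b} a≤b = ℚP.toℚᵘ-cancel-≤
  (ℚᵘP.≤-respʳ-≃ (ℚᵘP.≃-sym (toℚᵘ-ℕ→ℚ b)) (ℚᵘP.≤-respˡ-≃ (ℚᵘP.≃-sym (toℚᵘ-ℕ→ℚ a))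
    (ℚᵘ.*≤* (ℤP.*-monoʳ-≤-nonNeg (+ 1) (ℤ.+≤+ a≤b)))))

ℕ→ℚ-cancel-≤ : ∀ {a b} → ℕ→ℚ a ≤ ℕ→ℚ b → a ℕ.≤ b
ℕ→ℚ-cancel-≤ {a} {b} le
  with ℚᵘP.≤-respʳ-≃ (toℚᵘ-ℕ→ℚ b) (ℚᵘP.≤-respˡ-≃ (toℚᵘ-ℕ→ℚ a) (ℚP.toℚᵘ-mono-≤ le))
... | ℚᵘ.*≤* a≤b = ℤP.drop‿+≤+ (subst₂ ℤ._≤_ (ℤP.*-identityʳ (+ a)) (ℤP.*-identityʳ (+ b)) a≤b)

0≤ℕ→ℚ : ∀ a → 0ℚ ≤ ℕ→ℚ a
0≤ℕ→ℚ a = ℕ→ℚ-mono-≤ {0} {a} ℕ.z≤n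

-- recip 0 = 0 mirrors the value dI takes on empty vertex sets.
recip : ℕ → ℚ
recip ℕ.zero    = 0ℚ
recip (ℕ.suc m) = + 1 / ℕ.suc m

private
  toℚᵘ-/ : ∀ a m → toℚᵘ (+ a / ℕ.suc m) ℚᵘ.≃ ℚᵘ.mkℚᵘ (+ a) m
  toℚᵘ-/ a m = ℚP.toℚᵘ-fromℚᵘ (ℚᵘ.mkℚᵘ (+ a) m)

/-suc : ∀ a m → + a / ℕ.suc m ≡ ℕ→ℚ a * recip (ℕ.suc m)
/-suc a m = ℚP.toℚᵘ-injective (ℚᵘP.≃-trans (toℚᵘ-/ a m) (ℚᵘP.≃-sym
  (ℚᵘP.≃-trans (ℚP.toℚᵘ-homo-* (ℕ→ℚ a) (recip (ℕ.suc m)))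
  (ℚᵘP.≃-trans (ℚᵘP.*-cong (toℚᵘ-ℕ→ℚ a) (toℚᵘ-/ 1 m))
  (ℚᵘ.*≡* (cong₂ ℤ._*_ (ℤP.*-identityʳ (+ a)) (cong +_ (sym (ℕP.+-identityʳ (ℕ.suc m))))))))))

recip-* : ∀ a b → recip (a ℕ.* b) ≡ recip a * recip b
recip-* ℕ.zero    b         = sym (ℚP.*-zeroˡ (recip b))
recip-* (ℕ.suc a) ℕ.zero    = trans (cong recip (ℕP.*-zeroʳ a)) (sym (ℚP.*-zeroʳ (recip (ℕ.suc a))))
recip-* (ℕ.suc a) (ℕ.suc b) = ℚP.toℚᵘ-injective (ℚᵘP.≃-trans (toℚᵘ-/ 1 _) (ℚᵘP.≃-sym
  (ℚᵘP.≃-trans (ℚP.toℚᵘ-homo-* (recip (ℕ.suc a)) (recip (ℕ.suc b)))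
  (ℚᵘP.*-cong (toℚᵘ-/ 1 a) (toℚᵘ-/ 1 b)))))

recip-inverseˡ : ∀ m → recip (ℕ.suc m) * ℕ→ℚ (ℕ.suc m) ≡ 1ℚ
recip-inverseˡ m = ℚP.toℚᵘ-injective (ℚᵘP.≃-trans (ℚP.toℚᵘ-homo-* (recip (ℕ.suc m)) (ℕ→ℚ (ℕ.suc m)))
  (ℚᵘP.≃-trans (ℚᵘP.*-cong (toℚᵘ-/ 1 m) (toℚᵘ-ℕ→ℚ (ℕ.suc m)))
  (ℚᵘ.*≡* (cong (λ x → + ℕ.suc x) (ℕP.*-distribʳ-+ 1 m 0)))))

0≤recip : ∀ a → 0ℚ ≤ recip a
0≤recip ℕ.zero    = ℚP.≤-refl
0≤recip (ℕ.suc a) =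
  ℚP.toℚᵘ-cancel-≤ (ℚᵘP.≤-respʳ-≃ (ℚᵘP.≃-sym (toℚᵘ-/ 1 a)) (ℚᵘ.*≤* (ℤ.+≤+ ℕ.z≤n)))

*-monoˡ-≤ : ∀ r {x y} → 0ℚ ≤ r → x ≤ y → r * x ≤ r * y
*-monoˡ-≤ r 0≤r = ℚP.*-monoˡ-≤-nonNeg r {{ℚ.nonNegative 0≤r}}

*-monoʳ-≤ : ∀ r {x y} → 0ℚ ≤ r → x ≤ y → x * r ≤ y * r
*-monoʳ-≤ r 0≤r = ℚP.*-monoʳ-≤-nonNeg r {{ℚ.nonNegative 0≤r}}

*-mono-≤-nonNeg : ∀ {a b c d} → 0ℚ ≤ a → 0ℚ ≤ c → a ≤ b → c ≤ d → a * c ≤ b * d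
*-mono-≤-nonNeg {a} {b} {c} {d} 0≤a 0≤c a≤b c≤d = ℚP.≤-trans
  (*-monoˡ-≤ a 0≤a c≤d)
  (*-monoʳ-≤ d (ℚP.≤-trans 0≤c c≤d) a≤b)

0≤* : ∀ {a b} → 0ℚ ≤ a → 0ℚ ≤ b → 0ℚ ≤ a * b
0≤* {a} {b} 0≤a 0≤b = subst (_≤ a * b) (ℚP.*-zeroʳ a) (*-monoˡ-≤ a 0≤a 0≤b)

*-rescale-≤ : ∀ {a b x y} → 0ℚ ≤ b → a * x ≤ y → (a * b) * x ≤ b * y
*-rescale-≤ {a} {b} {x} {y} 0≤b ax≤y = begin
  (a * b) * x ≡⟨ swap a b x ⟩
  b * (a * x) ≤⟨ *-monoˡ-≤ b 0≤b ax≤y ⟩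
  b * y       ∎
  where
  open ℚP.≤-Reasoning
  swap : ∀ a b x → (a * b) * x ≡ b * (a * x)
  swap = solve-∀ ℚ-ring

+-cancelˡ-≤ : ∀ x {y z} → x + y ≤ x + z → y ≤ z
+-cancelˡ-≤ x {y} {z} x+y≤x+z = begin
  y               ≡⟨ sym (cancel x y) ⟩
  ℚ.- x + (x + y) ≤⟨ ℚP.+-monoʳ-≤ (ℚ.- x) x+y≤x+z ⟩
  ℚ.- x + (x + z) ≡⟨ cancel x z ⟩
  z               ∎
  where
  open ℚP.≤-Reasoning
  cancel : ∀ x y → ℚ.- x + (x + y) ≡ y
  cancel = solve-∀ ℚ-ring

0≤inv : ∀ {p} (p>0 : 0ℚ < p) → 0ℚ ≤ inv p p>0
0≤inv {p} p>0 = ℚP.<⇒≤ (ℚP.positive⁻¹ (inv p p>0) {{ℚP.1/pos⇒pos p {{ℚ.positive p>0}}}})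

module _ {p : ℚ} (p>0 : 0ℚ < p) where

  private
    instance
      p≢0 : ℚ.NonZero p
      p≢0 = ℚ.>-nonZero p>0

  inv≤⇒1≤* : ∀ {x} → inv p p>0 ≤ x → 1ℚ ≤ p * x
  inv≤⇒1≤* {x} p⁻¹≤x = begin
    1ℚ          ≡⟨ sym (ℚP.*-inverseʳ p) ⟩
    p * inv p p>0 ≤⟨ *-monoˡ-≤ p (ℚP.<⇒≤ p>0) p⁻¹≤x ⟩
    p * x       ∎
    where open ℚP.≤-Reasoning

  1≤*⇒inv≤ : ∀ {x} → 1ℚ ≤ p * x → inv p p>0 ≤ x
  1≤*⇒inv≤ {x} 1≤px = begin
    inv p p>0              ≡⟨ sym (ℚP.*-identityʳ _) ⟩
    inv p p>0 * 1ℚ         ≤⟨ *-monoˡ-≤ (inv p p>0) (0≤inv p>0) 1≤px ⟩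
    inv p p>0 * (p * x)    ≡⟨ sym (ℚP.*-assoc (inv p p>0) p x) ⟩
    (inv p p>0 * p) * x    ≡⟨ cong (_* x) (ℚP.*-inverseˡ p) ⟩
    1ℚ * x                 ≡⟨ ℚP.*-identityˡ x ⟩
    x                      ∎
    where open ℚP.≤-Reasoning

module _ {a b : ℚ} (ab>0 : 0ℚ < a * b) where

  inv-*-weakenˡ : ∀ {x} (a>0 : 0ℚ < a) → 0ℚ ≤ b → b ≤ 1ℚ → 0ℚ ≤ x → inv (a * b) ab>0 ≤ x → inv a a>0 ≤ x
  inv-*-weakenˡ {x} a>0 0≤b b≤1 0≤x [ab]⁻¹≤x = 1≤*⇒inv≤ a>0 (begin
    1ℚ          ≤⟨ inv≤⇒1≤* ab>0 [ab]⁻¹≤x ⟩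
    (a * b) * x ≤⟨ *-rescale-≤ {a} 0≤b (ℚP.≤-refl {a * x}) ⟩
    b * (a * x) ≤⟨ *-monoʳ-≤ (a * x) (0≤* (ℚP.<⇒≤ a>0) 0≤x) b≤1 ⟩
    1ℚ * (a * x) ≡⟨ ℚP.*-identityˡ (a * x) ⟩
    a * x       ∎)
    where open ℚP.≤-Reasoning

  inv-*-transfer : ∀ {x y} (b>0 : 0ℚ < b) → inv (a * b) ab>0 ≤ x → a * x ≤ y → inv b b>0 ≤ y
  inv-*-transfer b>0 [ab]⁻¹≤x ax≤y = 1≤*⇒inv≤ b>0
    (ℚP.≤-trans (inv≤⇒1≤* ab>0 [ab]⁻¹≤x) (*-rescale-≤ {a} (ℚP.<⇒≤ b>0) ax≤y))

recip-antitone : ∀ {c a a'} (c>0 : 0ℚ < c) → 1 ℕ.≤ a → c * ℕ→ℚ a ≤ ℕ→ℚ a' → recip a' ≤ inv c c>0 * recip a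
recip-antitone {c} {a} {ℕ.zero} c>0 _ _ = 0≤* (0≤inv c>0) (0≤recip a)
recip-antitone {c} {ℕ.suc a} {ℕ.suc a'} c>0 _ ca≤a' = begin
  recip (ℕ.suc a')                                  ≡⟨ sym (ℚP.*-identityʳ _) ⟩
  recip (ℕ.suc a') * 1ℚ                             ≡⟨ cong (recip (ℕ.suc a') *_) (sym one) ⟩
  recip (ℕ.suc a') * ((c * ℕ→ℚ (ℕ.suc a)) * bound)   ≤⟨ *-monoˡ-≤ (recip (ℕ.suc a')) (0≤recip (ℕ.suc a'))
                                                         (*-monoʳ-≤ bound 0≤bound ca≤a') ⟩
  recip (ℕ.suc a') * (ℕ→ℚ (ℕ.suc a') * bound)        ≡⟨ sym (ℚP.*-assoc (recip (ℕ.suc a')) (ℕ→ℚ (ℕ.suc a')) bound) ⟩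
  (recip (ℕ.suc a') * ℕ→ℚ (ℕ.suc a')) * bound        ≡⟨ cong (_* bound) (recip-inverseˡ a') ⟩
  1ℚ * bound                                        ≡⟨ ℚP.*-identityˡ bound ⟩
  bound                                             ∎
  where
  open ℚP.≤-Reasoning
  bound = inv c c>0 * recip (ℕ.suc a)
  0≤bound : 0ℚ ≤ bound
  0≤bound = 0≤* (0≤inv c>0) (0≤recip (ℕ.suc a))
  regroup : ∀ c x i r → (c * x) * (i * r) ≡ (i * c) * (r * x)
  regroup = solve-∀ ℚ-ring
  one : (c * ℕ→ℚ (ℕ.suc a)) * bound ≡ 1ℚ
  one = trans (regroup c (ℕ→ℚ (ℕ.suc a)) (inv c c>0) (recip (ℕ.suc a)))
    (cong₂ _*_ (ℚP.*-inverseˡ c {{ℚ.>-nonZero c>0}}) (recip-inverseˡ a))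

recip-mediant-≤ : ∀ m .{{_ : NonZero m}} {F s} → s ≤ ℕ→ℚ m * F → recip m * s ≤ recip (ℕ.suc m) * (F + s)
recip-mediant-≤ (ℕ.suc k) {F} {s} s≤aF = begin
  r * s                   ≡⟨ sym (ℚP.*-identityʳ (r * s)) ⟩
  (r * s) * 1ℚ            ≡⟨ cong ((r * s) *_) (sym (recip-inverseˡ (ℕ.suc k))) ⟩
  (r * s) * (r' * a')     ≡⟨ cong (λ z → (r * s) * z) (*-comm-suc-* r' (ℕ.suc k)) ⟩
  (r * s) * (r' + a * r') ≡⟨ regroupˡ r r' s a ⟩
  (r * r') * (s + a * s)  ≤⟨ *-monoˡ-≤ (r * r') (0≤* (0≤recip (ℕ.suc k)) (0≤recip (ℕ.suc (ℕ.suc k))))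
                               (ℚP.+-monoˡ-≤ (a * s) s≤aF) ⟩
  (r * r') * (a * F + a * s) ≡⟨ regroupʳ r r' a F s ⟩
  r' * (F + s) * (r * a)  ≡⟨ cong (r' * (F + s) *_) (recip-inverseˡ k) ⟩
  r' * (F + s) * 1ℚ       ≡⟨ ℚP.*-identityʳ _ ⟩
  r' * (F + s)            ∎
  where
  open ℚP.≤-Reasoning
  a = ℕ→ℚ (ℕ.suc k)
  a' = ℕ→ℚ (ℕ.suc (ℕ.suc k))
  r = recip (ℕ.suc k)
  r' = recip (ℕ.suc (ℕ.suc k))
  *-comm-suc-* : ∀ x a → x * ℕ→ℚ (ℕ.suc a) ≡ x + ℕ→ℚ a * x
  *-comm-suc-* x a = trans (ℚP.*-comm x (ℕ→ℚ (ℕ.suc a))) (ℕ→ℚ-suc-* a x)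
  regroupˡ : ∀ r r' s a → (r * s) * (r' + a * r') ≡ (r * r') * (s + a * s)
  regroupˡ = solve-∀ ℚ-ring
  regroupʳ : ∀ r r' a F s → (r * r') * (a * F + a * s) ≡ r' * (F + s) * (r * a)
  regroupʳ = solve-∀ ℚ-ring

∑-mono-≤ : ∀ {n} {f g : Fin n → ℚ} → (∀ i → f i ≤ g i) → sum f ≤ sum g
∑-mono-≤ {ℕ.zero}  f≤g = ℚP.≤-refl
∑-mono-≤ {ℕ.suc n} f≤g = ℚP.+-mono-≤ (f≤g zero) (∑-mono-≤ (f≤g ∘ suc))

∑-mono-< : ∀ {n} {f g : Fin n → ℚ} → (∀ i → f i ≤ g i) → ∀ j → f j < g j → sum f < sum g
∑-mono-< f≤g zero    fj<gj = ℚP.+-mono-<-≤ fj<gj (∑-mono-≤ (f≤g ∘ suc))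
∑-mono-< f≤g (suc j) fj<gj = ℚP.+-mono-≤-< (f≤g zero) (∑-mono-< (f≤g ∘ suc) j fj<gj)

0≤∑ : ∀ {n} {f : Fin n → ℚ} → (∀ i → 0ℚ ≤ f i) → 0ℚ ≤ sum f
0≤∑ {ℕ.zero}  0≤f = ℚP.≤-refl
0≤∑ {ℕ.suc n} 0≤f = ℚP.+-mono-≤ (0≤f zero) (0≤∑ (0≤f ∘ suc))

≤∑ : ∀ {n} {f : Fin n → ℚ} → (∀ i → 0ℚ ≤ f i) → ∀ j → f j ≤ sum f
≤∑ {f = f} 0≤f zero = begin
  f zero           ≡⟨ sym (ℚP.+-identityʳ (f zero)) ⟩
  f zero + 0ℚ      ≤⟨ ℚP.+-monoʳ-≤ (f zero) (0≤∑ (0≤f ∘ suc)) ⟩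
  sum f            ∎
  where open ℚP.≤-Reasoning
≤∑ {f = f} 0≤f (suc j) = begin
  f (suc j)             ≤⟨ ≤∑ (0≤f ∘ suc) j ⟩
  sum (f ∘ suc)         ≡⟨ sym (ℚP.+-identityˡ _) ⟩
  0ℚ + sum (f ∘ suc)    ≤⟨ ℚP.+-monoˡ-≤ (sum (f ∘ suc)) (0≤f zero) ⟩
  sum f                 ∎
  where open ℚP.≤-Reasoning

∑-≤-const : ∀ {n} {f : Fin n → ℚ} {c} → (∀ i → f i ≤ c) → sum f ≤ ℕ→ℚ n * c
∑-≤-const {ℕ.zero}  {c = c} f≤c = ℚP.≤-reflexive (sym (ℚP.*-zeroˡ c))
∑-≤-const {ℕ.suc n} {c = c} f≤c = begin
  _                    ≤⟨ ℚP.+-mono-≤ (f≤c zero) (∑-≤-const (f≤c ∘ suc)) ⟩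
  c + ℕ→ℚ n * c        ≡⟨ sym (ℕ→ℚ-suc-* n c) ⟩
  ℕ→ℚ (ℕ.suc n) * c    ∎
  where open ℚP.≤-Reasoning

𝟙 : Bool → ℚ
𝟙 b = if b then 1ℚ else 0ℚ

𝟙-∧ : ∀ a b → 𝟙 (a ∧ b) ≡ 𝟙 a * 𝟙 b
𝟙-∧ true  b = sym (ℚP.*-identityˡ (𝟙 b))
𝟙-∧ false b = sym (ℚP.*-zeroˡ (𝟙 b))

𝟙-mono : ∀ {a b} → (T a → T b) → 𝟙 a ≤ 𝟙 b
𝟙-mono {false} {false} _   = ℚP.≤-refl
𝟙-mono {false} {true}  _   = ℚP.nonNegative⁻¹ 1ℚ
𝟙-mono {true}  {true}  _   = ℚP.≤-refl
𝟙-mono {true}  {false} a⇒b = ⊥-elim (a⇒b tt)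

∑⟨_⟩ : ∀ {N} → Subset N → (Fin N → ℚ) → ℚ
∑⟨ A ⟩ f = sum (λ u → 𝟙 (lookup A u) * f u)

∑⟨⟩-const : ∀ {N} (A : Subset N) c → ∑⟨ A ⟩ (λ _ → c) ≡ ℕ→ℚ ∣ A ∣ * c
∑⟨⟩-const []            c = sym (ℚP.*-zeroˡ c)
∑⟨⟩-const (outside ∷ A) c = trans (cong (_+ ∑⟨ A ⟩ (λ _ → c)) (ℚP.*-zeroˡ c))
  (trans (ℚP.+-identityˡ _) (∑⟨⟩-const A c))
∑⟨⟩-const (inside ∷ A)  c = begin
  1ℚ * c + ∑⟨ A ⟩ (λ _ → c)   ≡⟨ cong₂ _+_ (ℚP.*-identityˡ c) (∑⟨⟩-const A c) ⟩
  c + ℕ→ℚ ∣ A ∣ * c          ≡⟨ sym (ℕ→ℚ-suc-* ∣ A ∣ c) ⟩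
  ℕ→ℚ ∣ inside ∷ A ∣ * c      ∎
  where open ≡-Reasoning

∑⟨⟩-remove : ∀ {N} {A : Subset N} {v} (f : Fin N → ℚ) → v ∈ A → ∑⟨ A ⟩ f ≡ f v + ∑⟨ A - v ⟩ f
∑⟨⟩-remove {A = inside ∷ A} f here = begin
  1ℚ * f zero + ∑⟨ A ⟩ (f ∘ suc)                 ≡⟨ pull (f zero) _ ⟩
  f zero + (0ℚ * f zero + ∑⟨ A ⟩ (f ∘ suc))
    ≡⟨ cong (λ B → f zero + (0ℚ * f zero + ∑⟨ B ⟩ (f ∘ suc))) (sym (SubsetP.p─⊥≡p A)) ⟩
  f zero + ∑⟨ (inside ∷ A) - zero ⟩ f            ∎
  where
  open ≡-Reasoning
  pull : ∀ x s → 1ℚ * x + s ≡ x + (0ℚ * x + s)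
  pull = solve-∀ ℚ-ring
∑⟨⟩-remove {A = a ∷ A} {suc v} f (there v∈A) = begin
  𝟙 a * f zero + ∑⟨ A ⟩ (f ∘ suc)
    ≡⟨ cong (λ z → 𝟙 a * f zero + z) (∑⟨⟩-remove (f ∘ suc) v∈A) ⟩
  𝟙 a * f zero + (f (suc v) + ∑⟨ A - v ⟩ (f ∘ suc))     ≡⟨ exchange (𝟙 a * f zero) (f (suc v)) _ ⟩
  f (suc v) + (𝟙 a * f zero + ∑⟨ A - v ⟩ (f ∘ suc))     ∎
  where
  open ≡-Reasoning
  exchange : ∀ x y z → x + (y + z) ≡ y + (x + z)
  exchange = solve-∀ ℚ-ring

∣∣-remove : ∀ {N} {A : Subset N} {v} → v ∈ A → ∣ A ∣ ≡ ℕ.suc ∣ A - v ∣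
∣∣-remove {A = inside ∷ A} here = cong (ℕ.suc ∘ ∣_∣) (sym (SubsetP.p─⊥≡p A))
∣∣-remove {A = inside ∷ A}  (there v∈A) = cong ℕ.suc (∣∣-remove v∈A)
∣∣-remove {A = outside ∷ A} (there v∈A) = ∣∣-remove v∈A

∑⟨⟩-*-distribˡ : ∀ {N} (A : Subset N) c f → c * ∑⟨ A ⟩ f ≡ ∑⟨ A ⟩ (λ u → c * f u)
∑⟨⟩-*-distribˡ A c f = trans (*-distribˡ-sum c (λ u → 𝟙 (lookup A u) * f u))
  (sum-cong-≗ (λ u → exchange c (𝟙 (lookup A u)) (f u)))
  where
  exchange : ∀ x y z → x * (y * z) ≡ y * (x * z)
  exchange = solve-∀ ℚ-ring

∑⟨⟩-∑-comm : ∀ {N n} (A : Subset N) (f : Fin n → Fin N → ℚ) →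
  sum (λ b → ∑⟨ A ⟩ (f b)) ≡ ∑⟨ A ⟩ (λ u → sum (λ b → f b u))
∑⟨⟩-∑-comm A f = trans (∑-comm (λ b u → 𝟙 (lookup A u) * f b u))
  (sum-cong-≗ (λ u → sym (*-distribˡ-sum (𝟙 (lookup A u)) (λ b → f b u))))

lookup⇒∈ : ∀ {N} {A : Subset N} {u} → lookup A u ≡ true → u ∈ A
lookup⇒∈ {A = A} {u} = VecP.lookup⇒[]= u A

∑⟨⟩-mono-< : ∀ {N} {A : Subset N} {f g : Fin N → ℚ} → (∀ u → u ∈ A → f u ≤ g u) →
  ∀ {v} → v ∈ A → f v < g v → ∑⟨ A ⟩ f < ∑⟨ A ⟩ g
∑⟨⟩-mono-< {A = A} {f} {g} f≤g {v} v∈A fv<gv =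
  ∑-mono-< pointwise v (subst (λ b → 𝟙 b * f v < 𝟙 b * g v) (sym (VecP.[]=⇒lookup v∈A)) (weaken fv<gv))
  where
  weaken : ∀ {x y} → x < y → 1ℚ * x < 1ℚ * y
  weaken {x} {y} = subst₂ _<_ (sym (ℚP.*-identityˡ x)) (sym (ℚP.*-identityˡ y))
  pointwise : ∀ u → 𝟙 (lookup A u) * f u ≤ 𝟙 (lookup A u) * g u
  pointwise u with lookup A u in eq
  ... | true  = ℚP.*-monoˡ-≤-nonNeg 1ℚ (f≤g u (lookup⇒∈ eq))
  ... | false = ℚP.≤-reflexive (trans (ℚP.*-zeroˡ (f u)) (sym (ℚP.*-zeroˡ (g u))))

nonempty : ∀ {N} (A : Subset N) → 1 ℕ.≤ ∣ A ∣ → Subset.Nonempty A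
nonempty {N} A 1≤∣A∣ with SubsetP.nonempty? A
... | yes A≢∅ = A≢∅
... | no  A≡∅ = ⊥-elim (ℕP.<⇒≢ 1≤∣A∣ (sym ∣A∣≡0))
  where
  ∣A∣≡0 : ∣ A ∣ ≡ 0
  ∣A∣≡0 = trans (cong ∣_∣ (SubsetP.Empty-unique A≡∅)) (SubsetP.∣⊥∣≡0 N)

∃-≥-average : ∀ {N} (A : Subset N) (f : Fin N → ℚ) → 1 ℕ.≤ ∣ A ∣ →
  ∃[ v ] v ∈ A × ∑⟨ A ⟩ f ≤ ℕ→ℚ ∣ A ∣ * f v
∃-≥-average A f 1≤∣A∣ with FinP.any? (λ v → v SubsetP.∈? A ×-dec ∑⟨ A ⟩ f ℚP.≤? ℕ→ℚ ∣ A ∣ * f v)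
... | yes (v , v∈A , S≤) = v , v∈A , S≤
... | no  ∄v = ⊥-elim (ℚP.<-irrefl refl (begin-strict
  ℕ→ℚ ∣ A ∣ * ∑⟨ A ⟩ f             ≡⟨ ∑⟨⟩-*-distribˡ A (ℕ→ℚ ∣ A ∣) f ⟩
  ∑⟨ A ⟩ (λ u → ℕ→ℚ ∣ A ∣ * f u)   <⟨ ∑⟨⟩-mono-< (λ u u∈A → ℚP.<⇒≤ (below u∈A)) v∈A (below v∈A) ⟩
  ∑⟨ A ⟩ (λ _ → ∑⟨ A ⟩ f)          ≡⟨ ∑⟨⟩-const A (∑⟨ A ⟩ f) ⟩
  ℕ→ℚ ∣ A ∣ * ∑⟨ A ⟩ f             ∎))
  where
  open ℚP.≤-Reasoning
  below : ∀ {u} → u ∈ A → ℕ→ℚ ∣ A ∣ * f u < ∑⟨ A ⟩ f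
  below {u} u∈A = ℚP.≰⇒> (λ S≤ → ∄v (u , u∈A , S≤))
  v∈A = proj₂ (nonempty A 1≤∣A∣)

∃-remove-average-≤ : ∀ {N} (A : Subset N) (f : Fin N → ℚ) → 2 ℕ.≤ ∣ A ∣ →
  ∃[ v ] v ∈ A × recip ∣ A - v ∣ * ∑⟨ A - v ⟩ f ≤ recip ∣ A ∣ * ∑⟨ A ⟩ f
∃-remove-average-≤ A f 2≤∣A∣ with ∃-≥-average A f (ℕP.≤-trans (ℕ.s≤s ℕ.z≤n) 2≤∣A∣)
... | v , v∈A , S≤ = v , v∈A ,
  subst₂ (λ a S → recip ∣ A - v ∣ * ∑⟨ A - v ⟩ f ≤ recip a * S) (sym ∣A∣≡) (sym S≡)
    (recip-mediant-≤ ∣ A - v ∣ {{ℕ.>-nonZero 1≤∣A-v∣}} (+-cancelˡ-≤ (f v) (begin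
      f v + ∑⟨ A - v ⟩ f              ≡⟨ sym S≡ ⟩
      ∑⟨ A ⟩ f                        ≤⟨ S≤ ⟩
      ℕ→ℚ ∣ A ∣ * f v                  ≡⟨ cong (λ a → ℕ→ℚ a * f v) ∣A∣≡ ⟩
      ℕ→ℚ (ℕ.suc ∣ A - v ∣) * f v      ≡⟨ ℕ→ℚ-suc-* ∣ A - v ∣ (f v) ⟩
      f v + ℕ→ℚ ∣ A - v ∣ * f v        ∎)))
  where
  open ℚP.≤-Reasoning
  ∣A∣≡ = ∣∣-remove v∈A
  S≡ = ∑⟨⟩-remove f v∈A
  1≤∣A-v∣ : 1 ℕ.≤ ∣ A - v ∣
  1≤∣A-v∣ = ℕP.≤-pred (subst (2 ℕ.≤_) ∣A∣≡ 2≤∣A∣)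

∧-map : ∀ {a a' b b'} → (T a → T a') → (T b → T b') → T (a ∧ b) → T (a' ∧ b')
∧-map f g t = Equivalence.from BoolP.T-∧ (Data.Product.map f g (Equivalence.to BoolP.T-∧ t))

lookup-⊆ : ∀ {N} {A A' : Subset N} {u} → A' ⊆ A → T (lookup A' u) → T (lookup A u)
lookup-⊆ A'⊆A t =
  Equivalence.from BoolP.T-≡ (VecP.[]=⇒lookup (A'⊆A (lookup⇒∈ (Equivalence.to BoolP.T-≡ t))))

inᴵ-⊆ : ∀ {J I} x → J ⊆ᴵ I → T (inᴵ x J) → T (inᴵ x I)
inᴵ-⊆ {J} x J⊆I t with Equivalence.to (BoolP.T-∧ {lo J ℤ.≤ᵇ x}) t
... | lo≤ᵇx , x≤ᵇhi with J⊆I x (ℤP.≤ᵇ⇒≤ lo≤ᵇx , ℤP.≤ᵇ⇒≤ x≤ᵇhi)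
...   | lo≤x , x≤hi = Equivalence.from BoolP.T-∧ (ℤP.≤⇒≤ᵇ lo≤x , ℤP.≤⇒≤ᵇ x≤hi)

module _ {N : ℕ} (H : EOGraph N) where

  counted : Interval → Subset N → Subset N → Fin N → Fin N → Bool
  counted I A B u v = lookup A u ∧ lookup B v ∧ edge H u v ∧ inᴵ (label H u v) I

  degree : Interval → Subset N → Fin N → ℚ
  degree I B u = sum (λ v → 𝟙 (lookup B v ∧ edge H u v ∧ inᴵ (label H u v) I))

  private
    ℕ→ℚ-sum-allFin : ∀ {n} (f : Fin n → ℕ) → ℕ→ℚ (ℕList.sum (List.map f (allFin n))) ≡ sum (ℕ→ℚ ∘ f)
    ℕ→ℚ-sum-allFin {ℕ.zero}  f = refl
    ℕ→ℚ-sum-allFin {ℕ.suc n} f = trans (ℕ→ℚ-+ (f zero) _) (cong (λ s → ℕ→ℚ (f zero) + s)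
      (trans (cong (ℕ→ℚ ∘ ℕList.sum) map-suc) (ℕ→ℚ-sum-allFin (f ∘ suc))))
      where
      map-suc : List.map f (List.tabulate suc) ≡ List.map (f ∘ suc) (allFin n)
      map-suc = trans (ListP.map-tabulate suc f) (sym (ListP.map-tabulate (λ i → i) (f ∘ suc)))

    ℕ→ℚ-if : ∀ b → ℕ→ℚ (if b then 1 else 0) ≡ 𝟙 b
    ℕ→ℚ-if true  = refl
    ℕ→ℚ-if false = refl

  eI≡∑∑ : ∀ I A B → ℕ→ℚ (eI H I A B) ≡ sum (λ u → sum (λ v → 𝟙 (counted I A B u v)))
  eI≡∑∑ I A B = trans (ℕ→ℚ-sum-allFin (λ u → ℕList.sum (List.map (cell u) (allFin N))))
    (sum-cong-≗ (λ u → trans (ℕ→ℚ-sum-allFin (cell u))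
      (sum-cong-≗ (λ v → ℕ→ℚ-if (counted I A B u v)))))
    where
    cell : Fin N → Fin N → ℕ
    cell u v = if counted I A B u v then 1 else 0

  eI≡∑⟨⟩degree : ∀ I A B → ℕ→ℚ (eI H I A B) ≡ ∑⟨ A ⟩ (degree I B)
  eI≡∑⟨⟩degree I A B = trans (eI≡∑∑ I A B) (sum-cong-≗ (λ u →
    trans (sum-cong-≗ (λ v → 𝟙-∧ (lookup A u) (joins u v)))
      (sym (*-distribˡ-sum (𝟙 (lookup A u)) (λ v → 𝟙 (joins u v))))))
    where
    joins : Fin N → Fin N → Bool
    joins u v = lookup B v ∧ edge H u v ∧ inᴵ (label H u v) I

  eI-mono : ∀ {J I A A' B B'} → J ⊆ᴵ I → A' ⊆ A → B' ⊆ B → ℕ→ℚ (eI H J A' B') ≤ ℕ→ℚ (eI H I A B)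
  eI-mono {J} {I} {A} {A'} {B} {B'} J⊆I A'⊆A B'⊆B =
    subst₂ _≤_ (sym (eI≡∑∑ J A' B')) (sym (eI≡∑∑ I A B)) (∑-mono-≤ (λ u → ∑-mono-≤ (λ v → 𝟙-mono
      (∧-map (lookup-⊆ A'⊆A) (∧-map (lookup-⊆ B'⊆B)
        (∧-map {edge H u v} (λ e → e) (inᴵ-⊆ (label H u v) J⊆I)))))))

  dI≡ : ∀ I A B → dI H I A B ≡ ℕ→ℚ (eI H I A B) * (recip ∣ A ∣ * recip ∣ B ∣)
  dI≡ I A B with ∣ A ∣ ℕ.* ∣ B ∣ | recip-* ∣ A ∣ ∣ B ∣
  ... | ℕ.zero  | recip≡ = trans (sym (ℚP.*-zeroʳ e)) (cong (e *_) recip≡)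
    where e = ℕ→ℚ (eI H I A B)
  ... | ℕ.suc m | recip≡ = trans (/-suc (eI H I A B) m) (cong (ℕ→ℚ (eI H I A B) *_) recip≡)

  0≤dI : ∀ I A B → 0ℚ ≤ dI H I A B
  0≤dI I A B = subst (0ℚ ≤_) (sym (dI≡ I A B))
    (0≤* (0≤ℕ→ℚ (eI H I A B)) (0≤* (0≤recip ∣ A ∣) (0≤recip ∣ B ∣)))

  dI-as-average : ∀ I A B → dI H I A B ≡ recip ∣ A ∣ * ∑⟨ A ⟩ (λ u → recip ∣ B ∣ * degree I B u)
  dI-as-average I A B = begin
    dI H I A B                                  ≡⟨ dI≡ I A B ⟩
    ℕ→ℚ (eI H I A B) * (recip ∣ A ∣ * recip ∣ B ∣)
      ≡⟨ cong (_* (recip ∣ A ∣ * recip ∣ B ∣)) (eI≡∑⟨⟩degree I A B) ⟩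
    ∑⟨ A ⟩ (degree I B) * (recip ∣ A ∣ * recip ∣ B ∣)
      ≡⟨ regroup (∑⟨ A ⟩ (degree I B)) (recip ∣ A ∣) (recip ∣ B ∣) ⟩
    recip ∣ A ∣ * (recip ∣ B ∣ * ∑⟨ A ⟩ (degree I B))
      ≡⟨ cong (recip ∣ A ∣ *_) (∑⟨⟩-*-distribˡ A (recip ∣ B ∣) (degree I B)) ⟩
    recip ∣ A ∣ * ∑⟨ A ⟩ (λ u → recip ∣ B ∣ * degree I B u) ∎
    where
    open ≡-Reasoning
    regroup : ∀ e a b → e * (a * b) ≡ a * (b * e)
    regroup = solve-∀ ℚ-ring

  dI-⊆-≤ : ∀ {J I A A' B B' c} (c>0 : 0ℚ < c) → J ⊆ᴵ I → A' ⊆ A → B' ⊆ B →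
    1 ℕ.≤ ∣ A ∣ → 1 ℕ.≤ ∣ B ∣ →
    c * ℕ→ℚ ∣ A ∣ ≤ ℕ→ℚ ∣ A' ∣ → c * ℕ→ℚ ∣ B ∣ ≤ ℕ→ℚ ∣ B' ∣ →
    dI H J A' B' ≤ (inv c c>0 * inv c c>0) * dI H I A B
  dI-⊆-≤ {J} {I} {A} {A'} {B} {B'} {c} c>0 J⊆I A'⊆A B'⊆B 1≤∣A∣ 1≤∣B∣ cA≤A' cB≤B' = begin
    dI H J A' B'                                   ≡⟨ dI≡ J A' B' ⟩
    ℕ→ℚ (eI H J A' B') * (recip ∣ A' ∣ * recip ∣ B' ∣)
      ≤⟨ *-mono-≤-nonNeg (0≤ℕ→ℚ (eI H J A' B')) (0≤* (0≤recip ∣ A' ∣) (0≤recip ∣ B' ∣))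
           (eI-mono J⊆I A'⊆A B'⊆B)
           (*-mono-≤-nonNeg (0≤recip ∣ A' ∣) (0≤recip ∣ B' ∣)
             (recip-antitone {a = ∣ A ∣} {∣ A' ∣} c>0 1≤∣A∣ cA≤A')
             (recip-antitone {a = ∣ B ∣} {∣ B' ∣} c>0 1≤∣B∣ cB≤B')) ⟩
    ℕ→ℚ (eI H I A B) * ((c⁻¹ * recip ∣ A ∣) * (c⁻¹ * recip ∣ B ∣))
      ≡⟨ regroup (ℕ→ℚ (eI H I A B)) c⁻¹ (recip ∣ A ∣) (recip ∣ B ∣) ⟩
    (c⁻¹ * c⁻¹) * (ℕ→ℚ (eI H I A B) * (recip ∣ A ∣ * recip ∣ B ∣))
      ≡⟨ cong ((c⁻¹ * c⁻¹) *_) (sym (dI≡ I A B)) ⟩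
    (c⁻¹ * c⁻¹) * dI H I A B                       ∎
    where
    open ℚP.≤-Reasoning
    c⁻¹ = inv c c>0
    regroup : ∀ e i a b → e * ((i * a) * (i * b)) ≡ (i * i) * (e * (a * b))
    regroup = solve-∀ ℚ-ring

-- Colour classes of a coloured complete graph

≡ᵇ-sym : ∀ a b → (a ℕ.≡ᵇ b) ≡ (b ℕ.≡ᵇ a)
≡ᵇ-sym ℕ.zero    ℕ.zero    = refl
≡ᵇ-sym ℕ.zero    (ℕ.suc b) = refl
≡ᵇ-sym (ℕ.suc a) ℕ.zero    = refl
≡ᵇ-sym (ℕ.suc a) (ℕ.suc b) = ≡ᵇ-sym a b

𝟙-≤ᵇ-suc : ∀ c k → 𝟙 (c ℕ.≤ᵇ ℕ.suc k) ≡ 𝟙 (c ℕ.≤ᵇ k) + 𝟙 (c ℕ.≡ᵇ ℕ.suc k)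
𝟙-≤ᵇ-suc ℕ.zero    k = refl
𝟙-≤ᵇ-suc (ℕ.suc c) k = 𝟙-<ᵇ-suc c k
  where
  𝟙-<ᵇ-suc : ∀ c k → 𝟙 (c ℕ.<ᵇ ℕ.suc k) ≡ 𝟙 (c ℕ.<ᵇ k) + 𝟙 (c ℕ.≡ᵇ k)
  𝟙-<ᵇ-suc ℕ.zero    ℕ.zero    = refl
  𝟙-<ᵇ-suc ℕ.zero    (ℕ.suc k) = refl
  𝟙-<ᵇ-suc (ℕ.suc c) ℕ.zero    = refl
  𝟙-<ᵇ-suc (ℕ.suc c) (ℕ.suc k) = 𝟙-<ᵇ-suc c k

𝟙-∧⁴ : ∀ a b c d → 𝟙 (a ∧ b ∧ c ∧ d) ≡ 𝟙 a * (𝟙 b * (𝟙 c * 𝟙 d))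
𝟙-∧⁴ a b c d = trans (𝟙-∧ a _) (cong (𝟙 a *_) (trans (𝟙-∧ b _) (cong (𝟙 b *_) (𝟙-∧ c d))))

module _ {N q : ℕ} (G : ColoredEOComplete N q) where

  colorLe-edge-sym : ∀ k u v → edge (colorLe G k) u v ≡ edge (colorLe G k) v u
  colorLe-edge-sym k u v = cong₂ (λ x y → not x ∧ y) (≡ᵇ-sym (toℕ u) (toℕ v)) (cong (ℕ._≤ᵇ k) (col-sym G u v))

  eI-colorLe-comm : ∀ k I A B → ℕ→ℚ (eI (colorLe G k) I A B) ≡ ℕ→ℚ (eI (colorLe G k) I B A)
  eI-colorLe-comm k I A B = begin
    ℕ→ℚ (eI H I A B)                                   ≡⟨ eI≡∑∑ H I A B ⟩
    sum (λ u → sum (λ v → 𝟙 (counted H I A B u v)))   ≡⟨ ∑-comm (λ u v → 𝟙 (counted H I A B u v)) ⟩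
    sum (λ v → sum (λ u → 𝟙 (counted H I A B u v)))   ≡⟨ sum-cong-≗ (λ v → sum-cong-≗ (λ u → swap u v)) ⟩
    sum (λ v → sum (λ u → 𝟙 (counted H I B A v u)))   ≡⟨ sym (eI≡∑∑ H I B A) ⟩
    ℕ→ℚ (eI H I B A)                                   ∎
    where
    open ≡-Reasoning
    H = colorLe G k
    exchange : ∀ a b x y → a * (b * (x * y)) ≡ b * (a * (x * y))
    exchange = solve-∀ ℚ-ring
    swap : ∀ u v → 𝟙 (counted H I A B u v) ≡ 𝟙 (counted H I B A v u)
    swap u v = begin
      𝟙 (counted H I A B u v)          ≡⟨ 𝟙-∧⁴ a b e l ⟩
      𝟙 a * (𝟙 b * (𝟙 e * 𝟙 l))        ≡⟨ exchange (𝟙 a) (𝟙 b) (𝟙 e) (𝟙 l) ⟩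
      𝟙 b * (𝟙 a * (𝟙 e * 𝟙 l))        ≡⟨ cong₂ (λ e l → 𝟙 b * (𝟙 a * (𝟙 e * 𝟙 (inᴵ l I))))
                                            (colorLe-edge-sym k u v) (lab-sym G u v) ⟩
      𝟙 b * (𝟙 a * (𝟙 e' * 𝟙 l'))      ≡⟨ sym (𝟙-∧⁴ b a e' l') ⟩
      𝟙 (counted H I B A v u)          ∎
      where
      a = lookup A u
      b = lookup B v
      e = edge H u v
      e' = edge H v u
      l = inᴵ (lab G u v) I
      l' = inᴵ (lab G v u) I

  dI-colorLe-comm : ∀ k I A B → dI (colorLe G k) I A B ≡ dI (colorLe G k) I B A
  dI-colorLe-comm k I A B = trans (dI≡ H I A B) (trans
    (cong₂ _*_ (eI-colorLe-comm k I A B) (ℚP.*-comm (recip ∣ A ∣) (recip ∣ B ∣))) (sym (dI≡ H I B A)))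
    where H = colorLe G k

  eI-colorLe-suc : ∀ k I A B → ℕ→ℚ (eI (colorLe G (ℕ.suc k)) I A B) ≡
    ℕ→ℚ (eI (colorLe G k) I A B) + ℕ→ℚ (eI (colorEq G (ℕ.suc k)) I A B)
  eI-colorLe-suc k I A B = begin
    ℕ→ℚ (eI H≤ I A B)                                  ≡⟨ eI≡∑∑ H≤ I A B ⟩
    sum (λ u → sum (λ v → 𝟙 (counted H≤ I A B u v)))   ≡⟨ sum-cong-≗ (λ u → trans (sum-cong-≗ (split u))
                                                            (∑-distrib-+ (cell H< u) (cell H= u))) ⟩
    sum (λ u → sum (cell H< u) + sum (cell H= u))       ≡⟨ ∑-distrib-+ (sum ∘ cell H<) (sum ∘ cell H=) ⟩
    sum (sum ∘ cell H<) + sum (sum ∘ cell H=)           ≡⟨ sym (cong₂ _+_ (eI≡∑∑ H< I A B) (eI≡∑∑ H= I A B)) ⟩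
    ℕ→ℚ (eI H< I A B) + ℕ→ℚ (eI H= I A B)               ∎
    where
    open ≡-Reasoning
    H≤ = colorLe G (ℕ.suc k)
    H< = colorLe G k
    H= = colorEq G (ℕ.suc k)
    cell : EOGraph N → Fin N → Fin N → ℚ
    cell H u v = 𝟙 (counted H I A B u v)
    distrib : ∀ a b x p₁ p₂ l →
      a * (b * ((x * (p₁ + p₂)) * l)) ≡ a * (b * ((x * p₁) * l)) + a * (b * ((x * p₂) * l))
    distrib = solve-∀ ℚ-ring
    split : ∀ u v → cell H≤ u v ≡ cell H< u v + cell H= u v
    split u v = begin
      cell H≤ u v                                     ≡⟨ 𝟙-∧⁴ a b (x ∧ p) l ⟩
      𝟙 a * (𝟙 b * (𝟙 (x ∧ p) * 𝟙 l))                 ≡⟨ cong (λ z → 𝟙 a * (𝟙 b * (z * 𝟙 l)))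
                                                          (trans (𝟙-∧ x p) (cong (𝟙 x *_) (𝟙-≤ᵇ-suc c k))) ⟩
      𝟙 a * (𝟙 b * ((𝟙 x * (𝟙 p₁ + 𝟙 p₂)) * 𝟙 l))     ≡⟨ distrib (𝟙 a) (𝟙 b) (𝟙 x) (𝟙 p₁) (𝟙 p₂) (𝟙 l) ⟩
      factored p₁ + factored p₂                       ≡⟨ sym (cong₂ _+_ (expand p₁) (expand p₂)) ⟩
      cell H< u v + cell H= u v                       ∎
      where
      a = lookup A u
      b = lookup B v
      x = not (toℕ u ℕ.≡ᵇ toℕ v)
      l = inᴵ (lab G u v) I
      c = col G u v
      p = c ℕ.≤ᵇ ℕ.suc k
      p₁ = c ℕ.≤ᵇ k
      p₂ = c ℕ.≡ᵇ ℕ.suc k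
      factored : Bool → ℚ
      factored p = 𝟙 a * (𝟙 b * ((𝟙 x * 𝟙 p) * 𝟙 l))
      expand : ∀ p → 𝟙 (a ∧ b ∧ (x ∧ p) ∧ l) ≡ factored p
      expand p = trans (𝟙-∧⁴ a b (x ∧ p) l) (cong (λ z → 𝟙 a * (𝟙 b * (z * 𝟙 l))) (𝟙-∧ x p))

  dI-colorLe-suc : ∀ k I A B →
    dI (colorLe G (ℕ.suc k)) I A B ≡ dI (colorLe G k) I A B + dI (colorEq G (ℕ.suc k)) I A B
  dI-colorLe-suc k I A B = begin
    dI (colorLe G (ℕ.suc k)) I A B      ≡⟨ dI≡ (colorLe G (ℕ.suc k)) I A B ⟩
    ℕ→ℚ (eI (colorLe G (ℕ.suc k)) I A B) * r
                                        ≡⟨ cong (_* r) (eI-colorLe-suc k I A B) ⟩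
    (e≤ + e=) * r                       ≡⟨ ℚP.*-distribʳ-+ r e≤ e= ⟩
    e≤ * r + e= * r                     ≡⟨ sym (cong₂ _+_ (dI≡ (colorLe G k) I A B) (dI≡ (colorEq G (ℕ.suc k)) I A B)) ⟩
    dI (colorLe G k) I A B + dI (colorEq G (ℕ.suc k)) I A B ∎
    where
    open ≡-Reasoning
    r = recip ∣ A ∣ * recip ∣ B ∣
    e≤ = ℕ→ℚ (eI (colorLe G k) I A B)
    e= = ℕ→ℚ (eI (colorEq G (ℕ.suc k)) I A B)

⋃ᶠ : ∀ {N n} → (Fin n → Subset N) → Subset N
⋃ᶠ = foldr _∪_ Subset.⊥

⊆-⋃ᶠ : ∀ {N n} (c : Fin n → Subset N) i → c i ⊆ ⋃ᶠ c
⊆-⋃ᶠ c zero    x∈ = SubsetP.p⊆p∪q (⋃ᶠ (c ∘ suc)) x∈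
⊆-⋃ᶠ c (suc i) x∈ = SubsetP.q⊆p∪q (c zero) (⋃ᶠ (c ∘ suc)) (⊆-⋃ᶠ (c ∘ suc) i x∈)

∈-⋃ᶠ⁻ : ∀ {N n} (c : Fin n → Subset N) {x} → x ∈ ⋃ᶠ c → ∃[ i ] x ∈ c i
∈-⋃ᶠ⁻ {n = ℕ.zero}  c x∈ = ⊥-elim (SubsetP.∉⊥ x∈)
∈-⋃ᶠ⁻ {n = ℕ.suc n} c x∈ with SubsetP.x∈p∪q⁻ (c zero) (⋃ᶠ (c ∘ suc)) x∈
... | inj₁ x∈c₀ = zero , x∈c₀
... | inj₂ x∈⋃  = Data.Product.map suc (λ x∈ci → x∈ci) (∈-⋃ᶠ⁻ (c ∘ suc) x∈⋃)

∣∪∣≤ : ∀ {N} (p q : Subset N) → ∣ p ∪ q ∣ ℕ.≤ ∣ p ∣ ℕ.+ ∣ q ∣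
∣∪∣≤ []            []            = ℕ.z≤n
∣∪∣≤ (inside  ∷ p) (inside  ∷ q) =
  ℕ.s≤s (ℕP.≤-trans (∣∪∣≤ p q) (ℕP.+-monoʳ-≤ ∣ p ∣ (ℕP.n≤1+n ∣ q ∣)))
∣∪∣≤ (inside  ∷ p) (outside ∷ q) = ℕ.s≤s (∣∪∣≤ p q)
∣∪∣≤ (outside ∷ p) (inside  ∷ q) =
  ℕP.≤-trans (ℕ.s≤s (∣∪∣≤ p q)) (ℕP.≤-reflexive (sym (ℕP.+-suc ∣ p ∣ ∣ q ∣)))
∣∪∣≤ (outside ∷ p) (outside ∷ q) = ∣∪∣≤ p q

∣⋃ᶠ∣≤ : ∀ {N n} (c : Fin n → Subset N) {m} → (∀ i → ∣ c i ∣ ≡ m) → ∣ ⋃ᶠ c ∣ ℕ.≤ n ℕ.* m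
∣⋃ᶠ∣≤ {N} {ℕ.zero}  c _      = ℕP.≤-reflexive (SubsetP.∣⊥∣≡0 N)
∣⋃ᶠ∣≤ {N} {ℕ.suc n} c ∣c∣≡m = ℕP.≤-trans (∣∪∣≤ (c zero) (⋃ᶠ (c ∘ suc)))
  (ℕP.+-mono-≤ (ℕP.≤-reflexive (∣c∣≡m zero)) (∣⋃ᶠ∣≤ (c ∘ suc) (∣c∣≡m ∘ suc)))

⋃ᶠ-share-≤ : ∀ {N n} (c : Fin n → Subset N) {m δ} → 0ℚ ≤ δ → δ * ℕ→ℚ n ≤ 1ℚ →
  (∀ i → ∣ c i ∣ ≡ m) → ∀ i → δ * ℕ→ℚ ∣ ⋃ᶠ c ∣ ≤ ℕ→ℚ ∣ c i ∣
⋃ᶠ-share-≤ {n = n} c {m} {δ} 0≤δ δn≤1 ∣c∣≡m i = begin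
  δ * ℕ→ℚ ∣ ⋃ᶠ c ∣          ≤⟨ *-monoˡ-≤ δ 0≤δ (ℕ→ℚ-mono-≤ (∣⋃ᶠ∣≤ c ∣c∣≡m)) ⟩
  δ * ℕ→ℚ (n ℕ.* m)         ≡⟨ cong (δ *_) (ℕ→ℚ-* n m) ⟩
  δ * (ℕ→ℚ n * ℕ→ℚ m)       ≡⟨ sym (ℚP.*-assoc δ (ℕ→ℚ n) (ℕ→ℚ m)) ⟩
  δ * ℕ→ℚ n * ℕ→ℚ m         ≤⟨ *-monoʳ-≤ (ℕ→ℚ m) (0≤ℕ→ℚ m) δn≤1 ⟩
  1ℚ * ℕ→ℚ m                ≡⟨ ℚP.*-identityˡ (ℕ→ℚ m) ⟩
  ℕ→ℚ m                     ≡⟨ cong ℕ→ℚ (sym (∣c∣≡m i)) ⟩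
  ℕ→ℚ ∣ c i ∣               ∎
  where open ℚP.≤-Reasoning

-- Shrinking a family of vertex sets without increasing its total density

module Shrinking {N : ℕ} (H : EOGraph N) (I : Interval)
                 (dI-comm : ∀ A B → dI H I A B ≡ dI H I B A) (n : ℕ) where

  Family : Set
  Family = Fin (ℕ.suc n) → Subset N

  _[_]≔_ : Family → Fin (ℕ.suc n) → Subset N → Family
  c [ i ]≔ X = updateAt c i (λ _ → X)

  pairDensity : Family → Fin (ℕ.suc n) → Fin (ℕ.suc n) → ℚ
  pairDensity c a b with a FinP.≟ b
  ... | yes _ = 0ℚ
  ... | no  _ = dI H I (c a) (c b)

  rowDensity : Family → Fin (ℕ.suc n) → ℚ
  rowDensity c a = sum (pairDensity c a)

  totalDensity : Family → ℚ
  totalDensity c = sum (rowDensity c)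

  pairDensity-diag : ∀ c a → pairDensity c a a ≡ 0ℚ
  pairDensity-diag c a with a FinP.≟ a
  ... | yes _   = refl
  ... | no  a≢a = ⊥-elim (a≢a refl)

  pairDensity-off : ∀ c {a b} → a ≢ b → pairDensity c a b ≡ dI H I (c a) (c b)
  pairDensity-off c {a} {b} a≢b with a FinP.≟ b
  ... | yes a≡b = ⊥-elim (a≢b a≡b)
  ... | no  _   = refl

  pairDensity-comm : ∀ c a b → pairDensity c a b ≡ pairDensity c b a
  pairDensity-comm c a b with a FinP.≟ b | b FinP.≟ a
  ... | yes _   | yes _   = refl
  ... | no  _   | no  _   = dI-comm (c a) (c b)
  ... | yes a≡b | no  b≢a = ⊥-elim (b≢a (sym a≡b))
  ... | no  a≢b | yes b≡a = ⊥-elim (a≢b (sym b≡a))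

  pairDensity-cong : ∀ {c c'} a b → c a ≡ c' a → c b ≡ c' b → pairDensity c a b ≡ pairDensity c' a b
  pairDensity-cong a b ca≡ cb≡ with a FinP.≟ b
  ... | yes _ = refl
  ... | no  _ = cong₂ (dI H I) ca≡ cb≡

  0≤pairDensity : ∀ c a b → 0ℚ ≤ pairDensity c a b
  0≤pairDensity c a b with a FinP.≟ b
  ... | yes _ = ℚP.≤-refl
  ... | no  _ = 0≤dI H I (c a) (c b)

  dI-≤-totalDensity : ∀ c {a b} → a ≢ b → dI H I (c a) (c b) ≤ totalDensity c
  dI-≤-totalDensity c {a} {b} a≢b = begin
    dI H I (c a) (c b)  ≡⟨ sym (pairDensity-off c a≢b) ⟩
    pairDensity c a b   ≤⟨ ≤∑ (0≤pairDensity c a) b ⟩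
    rowDensity c a      ≤⟨ ≤∑ (λ a → 0≤∑ (0≤pairDensity c a)) a ⟩
    totalDensity c      ∎
    where open ℚP.≤-Reasoning

  totalDensity-≤ : ∀ c {δ} → 0ℚ ≤ δ → (∀ a b → a ≢ b → dI H I (c a) (c b) ≤ δ) →
    totalDensity c ≤ ℕ→ℚ (ℕ.suc n ℕ.* ℕ.suc n) * δ
  totalDensity-≤ c {δ} 0≤δ dI≤δ = begin
    totalDensity c                                ≤⟨ ∑-≤-const (λ a → ∑-≤-const (pairDensity≤ a)) ⟩
    ℕ→ℚ (ℕ.suc n) * (ℕ→ℚ (ℕ.suc n) * δ)           ≡⟨ sym (ℚP.*-assoc (ℕ→ℚ (ℕ.suc n)) (ℕ→ℚ (ℕ.suc n)) δ) ⟩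
    ℕ→ℚ (ℕ.suc n) * ℕ→ℚ (ℕ.suc n) * δ             ≡⟨ cong (_* δ) (sym (ℕ→ℚ-* (ℕ.suc n) (ℕ.suc n))) ⟩
    ℕ→ℚ (ℕ.suc n ℕ.* ℕ.suc n) * δ                 ∎
    where
    open ℚP.≤-Reasoning
    pairDensity≤ : ∀ a b → pairDensity c a b ≤ δ
    pairDensity≤ a b with a FinP.≟ b
    ... | yes _   = 0≤δ
    ... | no  a≢b = dI≤δ a b a≢b

  restDensity : Family → Fin (ℕ.suc n) → ℚ
  restDensity c i = sum (λ a → sum (λ b → pairDensity c (punchIn i a) (punchIn i b)))

  totalDensity-split : ∀ c i → totalDensity c ≡ rowDensity c i + (rowDensity c i + restDensity c i)
  totalDensity-split c i = begin
    totalDensity c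
      ≡⟨ sum-remove {i = i} (rowDensity c) ⟩
    row + sum (λ a → rowDensity c (punchIn i a))
      ≡⟨ cong (λ s → row + s) (sum-cong-≗ (λ a → sum-remove {i = i} (pairDensity c (punchIn i a)))) ⟩
    row + sum (λ a → column a + sum (λ b → pairDensity c (punchIn i a) (punchIn i b)))
      ≡⟨ cong (λ s → row + s) (∑-distrib-+ column (λ a → sum (λ b → pairDensity c (punchIn i a) (punchIn i b)))) ⟩
    row + (sum column + restDensity c i)
      ≡⟨ cong (λ s → row + (s + restDensity c i)) column≡row ⟩
    row + (row + restDensity c i) ∎
    where
    open ≡-Reasoning
    row = rowDensity c i
    column : Fin n → ℚ
    column a = pairDensity c (punchIn i a) i
    column≡row : sum column ≡ row
    column≡row = begin
      sum column                           ≡⟨ sum-cong-≗ (λ a → pairDensity-comm c (punchIn i a) i) ⟩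
      others                               ≡⟨ sym (ℚP.+-identityˡ others) ⟩
      0ℚ + others                          ≡⟨ cong (_+ others) (sym (pairDensity-diag c i)) ⟩
      pairDensity c i i + others           ≡⟨ sym (sum-remove {i = i} (pairDensity c i)) ⟩
      row                                  ∎
      where
      others = sum (λ a → pairDensity c i (punchIn i a))

  restDensity-update : ∀ c i X → restDensity (c [ i ]≔ X) i ≡ restDensity c i
  restDensity-update c i X = sum-cong-≗ (λ a → sum-cong-≗ (λ b →
    pairDensity-cong (punchIn i a) (punchIn i b) (untouched a) (untouched b)))
    where
    untouched : ∀ a → (c [ i ]≔ X) (punchIn i a) ≡ c (punchIn i a)
    untouched a = updateAt-minimal (punchIn i a) i c (FinP.punchInᵢ≢i i a)

  totalDensity-update-≤ : ∀ c i X → rowDensity (c [ i ]≔ X) i ≤ rowDensity c i →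
    totalDensity (c [ i ]≔ X) ≤ totalDensity c
  totalDensity-update-≤ c i X row≤ = begin
    totalDensity c'                                  ≡⟨ totalDensity-split c' i ⟩
    rowDensity c' i + (rowDensity c' i + restDensity c' i)
                                                     ≡⟨ cong (λ r → rowDensity c' i + (rowDensity c' i + r)) (restDensity-update c i X) ⟩
    rowDensity c' i + (rowDensity c' i + restDensity c i)
                                                     ≤⟨ ℚP.+-mono-≤ row≤ (ℚP.+-mono-≤ row≤ ℚP.≤-refl) ⟩
    rowDensity c i + (rowDensity c i + restDensity c i) ≡⟨ sym (totalDensity-split c i) ⟩
    totalDensity c                                   ∎
    where
    open ℚP.≤-Reasoning
    c' = c [ i ]≔ X

  weightedDegree : Family → Fin (ℕ.suc n) → Fin N → ℚ
  weightedDegree c i u = sum (λ b → recip ∣ c (punchIn i b) ∣ * degree H I (c (punchIn i b)) u)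

  rowDensity-average : ∀ c i → rowDensity c i ≡ recip ∣ c i ∣ * ∑⟨ c i ⟩ (weightedDegree c i)
  rowDensity-average c i = begin
    rowDensity c i
      ≡⟨ sum-remove {i = i} (pairDensity c i) ⟩
    pairDensity c i i + sum (λ b → pairDensity c i (punchIn i b))
      ≡⟨ cong₂ _+_ (pairDensity-diag c i) (sum-cong-≗ (λ b → pairDensity-off c (FinP.punchInᵢ≢i i b ∘ sym))) ⟩
    0ℚ + sum (λ b → dI H I (c i) (c (punchIn i b)))
      ≡⟨ ℚP.+-identityˡ _ ⟩
    sum (λ b → dI H I (c i) (c (punchIn i b)))
      ≡⟨ sum-cong-≗ (λ b → dI-as-average H I (c i) (c (punchIn i b))) ⟩
    sum (λ b → recip ∣ c i ∣ * ∑⟨ c i ⟩ (term b))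
      ≡⟨ sym (*-distribˡ-sum (recip ∣ c i ∣) (λ b → ∑⟨ c i ⟩ (term b))) ⟩
    recip ∣ c i ∣ * sum (λ b → ∑⟨ c i ⟩ (term b))
      ≡⟨ cong (recip ∣ c i ∣ *_) (∑⟨⟩-∑-comm (c i) term) ⟩
    recip ∣ c i ∣ * ∑⟨ c i ⟩ (weightedDegree c i) ∎
    where
    open ≡-Reasoning
    term : Fin n → Fin N → ℚ
    term b u = recip ∣ c (punchIn i b) ∣ * degree H I (c (punchIn i b)) u

  rowDensity-update : ∀ c i X → rowDensity (c [ i ]≔ X) i ≡ recip ∣ X ∣ * ∑⟨ X ⟩ (weightedDegree c i)
  rowDensity-update c i X = begin
    rowDensity c' i                                     ≡⟨ rowDensity-average c' i ⟩
    recip ∣ c' i ∣ * ∑⟨ c' i ⟩ (weightedDegree c' i)    ≡⟨ cong (λ Y → recip ∣ Y ∣ * ∑⟨ Y ⟩ (weightedDegree c' i))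
                                                            (updateAt-updates i c) ⟩
    recip ∣ X ∣ * ∑⟨ X ⟩ (weightedDegree c' i)          ≡⟨ cong (λ s → recip ∣ X ∣ * s)
                                                            (sum-cong-≗ (λ u → cong (𝟙 (lookup X u) *_) (same-weights u))) ⟩
    recip ∣ X ∣ * ∑⟨ X ⟩ (weightedDegree c i)           ∎
    where
    open ≡-Reasoning
    c' = c [ i ]≔ X
    same-weights : ∀ u → weightedDegree c' i u ≡ weightedDegree c i u
    same-weights u = sum-cong-≗ (λ b → cong (λ Y → recip ∣ Y ∣ * degree H I Y u)
      (updateAt-minimal (punchIn i b) i c (FinP.punchInᵢ≢i i b)))

  -- Removing a vertex of above-average weighted degree does not increase the row density.
  shrink-step : ∀ c i → 2 ℕ.≤ ∣ c i ∣ → ∃[ v ] v ∈ c i × totalDensity (c [ i ]≔ (c i - v)) ≤ totalDensity c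
  shrink-step c i 2≤∣ci∣ = shrink (∃-remove-average-≤ (c i) (weightedDegree c i) 2≤∣ci∣)
    where
    average : Subset N → ℚ
    average X = recip ∣ X ∣ * ∑⟨ X ⟩ (weightedDegree c i)
    shrink : ∃[ v ] v ∈ c i × average (c i - v) ≤ average (c i) →
      ∃[ v ] v ∈ c i × totalDensity (c [ i ]≔ (c i - v)) ≤ totalDensity c
    shrink (v , v∈ci , average≤) = v , v∈ci , totalDensity-update-≤ c i (c i - v) (begin
      rowDensity (c [ i ]≔ (c i - v)) i  ≡⟨ rowDensity-update c i (c i - v) ⟩
      average (c i - v)                  ≤⟨ average≤ ⟩
      average (c i)                      ≡⟨ sym (rowDensity-average c i) ⟩
      rowDensity c i                     ∎)
      where open ℚP.≤-Reasoning

  record _≼_ (c' c : Family) : Set where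
    field
      ⊆-pointwise : ∀ j → c' j ⊆ c j
      density-≤   : totalDensity c' ≤ totalDensity c

  ≼-refl : ∀ {c} → c ≼ c
  ≼-refl = record { ⊆-pointwise = λ _ x∈ → x∈ ; density-≤ = ℚP.≤-refl }

  ≼-trans : ∀ {c'' c' c} → c'' ≼ c' → c' ≼ c → c'' ≼ c
  ≼-trans c''≼c' c'≼c = record
    { ⊆-pointwise = λ j x∈ → _≼_.⊆-pointwise c'≼c j (_≼_.⊆-pointwise c''≼c' j x∈)
    ; density-≤   = ℚP.≤-trans (_≼_.density-≤ c''≼c') (_≼_.density-≤ c'≼c)
    }

  remove-≼ : ∀ c i v → totalDensity (c [ i ]≔ (c i - v)) ≤ totalDensity c → (c [ i ]≔ (c i - v)) ≼ c
  remove-≼ c i v density≤ = record { ⊆-pointwise = ⊆-pointwise ; density-≤ = density≤ }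
    where
    ⊆-pointwise : ∀ j → (c [ i ]≔ (c i - v)) j ⊆ c j
    ⊆-pointwise j with j FinP.≟ i
    ... | yes refl = λ x∈ → SubsetP.p─q⊆p (c i) (Subset.⁅ v ⁆) (subst (_ ∈_) (updateAt-updates i c) x∈)
    ... | no  j≢i  = subst (λ X → X ⊆ c j) (sym (updateAt-minimal j i c j≢i)) (λ x∈ → x∈)

  ShrunkAt : Family → Fin (ℕ.suc n) → ℕ → Set
  ShrunkAt c i m = ∃[ c' ] c' ≼ c × ∣ c' i ∣ ≡ m × (∀ j → j ≢ i → c' j ≡ c j)

  ShrunkAt-≼ : ∀ {c₁ c i m} → c₁ ≼ c → (∀ j → j ≢ i → c₁ j ≡ c j) → ShrunkAt c₁ i m → ShrunkAt c i m
  ShrunkAt-≼ c₁≼c untouched₁ (c' , c'≼c₁ , ∣c'i∣≡m , untouched) =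
    c' , ≼-trans c'≼c₁ c₁≼c , ∣c'i∣≡m , λ j j≢i → trans (untouched j j≢i) (untouched₁ j j≢i)

  shrinkAt : ∀ {m} → 1 ℕ.≤ m → ∀ r c i → ∣ c i ∣ ≡ r ℕ.+ m → ShrunkAt c i m
  shrinkAt _ ℕ.zero c i ∣ci∣≡m = c , ≼-refl , ∣ci∣≡m , λ _ _ → refl
  shrinkAt {m} 1≤m (ℕ.suc r) c i ∣ci∣≡ = remove (shrink-step c i 2≤∣ci∣)
    where
    2≤∣ci∣ : 2 ℕ.≤ ∣ c i ∣
    2≤∣ci∣ = subst (2 ℕ.≤_) (sym ∣ci∣≡) (ℕ.s≤s (ℕP.≤-trans 1≤m (ℕP.m≤n+m m r)))
    remove : ∃[ v ] v ∈ c i × totalDensity (c [ i ]≔ (c i - v)) ≤ totalDensity c → ShrunkAt c i m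
    remove (v , v∈ci , density≤) = ShrunkAt-≼ (remove-≼ c i v density≤)
      (λ j j≢i → updateAt-minimal j i c j≢i) (shrinkAt 1≤m r (c [ i ]≔ (c i - v)) i ∣c₁i∣≡)
      where
      ∣c₁i∣≡ : ∣ (c [ i ]≔ (c i - v)) i ∣ ≡ r ℕ.+ m
      ∣c₁i∣≡ = trans (cong ∣_∣ (updateAt-updates i c)) (ℕP.suc-injective (trans (sym (∣∣-remove v∈ci)) ∣ci∣≡))

  ShrunkOn : Family → ℕ → List (Fin (ℕ.suc n)) → Set
  ShrunkOn c m js = ∃[ c' ] c' ≼ c × (∀ j → m ℕ.≤ ∣ c' j ∣) × (∀ j → j ∈ₗ js → ∣ c' j ∣ ≡ m)

  shrinkOn : ∀ {m} → 1 ℕ.≤ m → ∀ c → (∀ j → m ℕ.≤ ∣ c j ∣) → ∀ js → ShrunkOn c m js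
  shrinkOn 1≤m c m≤∣c∣ List.[]        = c , ≼-refl , m≤∣c∣ , λ _ ()
  shrinkOn {m} 1≤m c m≤∣c∣ (i List.∷ js) = extend (shrinkOn 1≤m c m≤∣c∣ js)
    where
    extend : ShrunkOn c m js → ShrunkOn c m (i List.∷ js)
    extend (c₁ , c₁≼c , m≤∣c₁∣ , done₁) =
      finish (shrinkAt 1≤m (∣ c₁ i ∣ ℕ.∸ m) c₁ i (sym (ℕP.m∸n+n≡m (m≤∣c₁∣ i))))
      where
      finish : ShrunkAt c₁ i m → ShrunkOn c m (i List.∷ js)
      finish (c₂ , c₂≼c₁ , ∣c₂i∣≡m , untouched) = c₂ , ≼-trans c₂≼c₁ c₁≼c , m≤∣c₂∣ , done₂
        where
        m≤∣c₂∣ : ∀ j → m ℕ.≤ ∣ c₂ j ∣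
        m≤∣c₂∣ j with j FinP.≟ i
        ... | yes refl = ℕP.≤-reflexive (sym ∣c₂i∣≡m)
        ... | no  j≢i  = subst (λ X → m ℕ.≤ ∣ X ∣) (sym (untouched j j≢i)) (m≤∣c₁∣ j)
        done₂ : ∀ j → j ∈ₗ i List.∷ js → ∣ c₂ j ∣ ≡ m
        done₂ j j∈ with j FinP.≟ i
        done₂ j _            | yes refl = ∣c₂i∣≡m
        done₂ j (here refl)  | no  j≢i  = ⊥-elim (j≢i refl)
        done₂ j (there j∈js) | no  j≢i  = trans (cong ∣_∣ (untouched j j≢i)) (done₁ j j∈js)

  shrinkAll : ∀ {m} → 1 ℕ.≤ m → ∀ c → (∀ j → m ℕ.≤ ∣ c j ∣) → ∃[ c' ] c' ≼ c × ∀ j → ∣ c' j ∣ ≡ m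
  shrinkAll 1≤m c m≤∣c∣ with shrinkOn 1≤m c m≤∣c∣ (allFin (ℕ.suc n))
  ... | c' , c'≼c , _ , done = c' , c'≼c , λ j → done j (∈-allFin j)

  record Balanced (W : Family) (s ε : ℚ) : Set where
    field
      partSize    : ℕ
      part        : Family
      1≤partSize  : 1 ℕ.≤ partSize
      s≤partSize  : s ≤ ℕ→ℚ partSize
      part-⊆      : ∀ j → part j ⊆ W j
      ∣part∣≡    : ∀ j → ∣ part j ∣ ≡ partSize
      part-sparse : ∀ {a b} → a ≢ b → dI H I (part a) (part b) ≤ ε

  -- The common size is that of the smallest set of the family.
  balance : ∀ W {s δ} → 1ℚ ≤ s → 0ℚ ≤ δ → (∀ j → s ≤ ℕ→ℚ ∣ W j ∣) →
    (∀ a b → a Fin.< b → dI H I (W a) (W b) < δ) → Balanced W s (ℕ→ℚ (ℕ.suc n ℕ.* ℕ.suc n) * δ)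
  balance W {s} {δ} 1≤s 0≤δ s≤∣W∣ W-sparse = shrunk (shrinkAll 1≤m W m≤∣W∣)
    where
    smallest = Extrema.argmin (∣_∣ ∘ W) zero (allFin (ℕ.suc n))
    m = ∣ W smallest ∣
    m≤∣W∣ : ∀ j → m ℕ.≤ ∣ W j ∣
    m≤∣W∣ j = All.lookup (Extrema.f[argmin]≤f[xs] {f = ∣_∣ ∘ W} zero (allFin (ℕ.suc n))) (∈-allFin j)
    1≤m : 1 ℕ.≤ m
    1≤m = ℕ→ℚ-cancel-≤ (ℚP.≤-trans 1≤s (s≤∣W∣ smallest))
    W-sparse-≢ : ∀ a b → a ≢ b → dI H I (W a) (W b) ≤ δ
    W-sparse-≢ a b a≢b with FinP.<-cmp a b
    ... | tri< a<b _ _ = ℚP.<⇒≤ (W-sparse a b a<b)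
    ... | tri≈ _ a≡b _ = ⊥-elim (a≢b a≡b)
    ... | tri> _ _ b<a = subst (_≤ δ) (dI-comm (W b) (W a)) (ℚP.<⇒≤ (W-sparse b a b<a))
    shrunk : ∃[ T ] T ≼ W × (∀ j → ∣ T j ∣ ≡ m) → Balanced W s (ℕ→ℚ (ℕ.suc n ℕ.* ℕ.suc n) * δ)
    shrunk (T , T≼W , ∣T∣≡m) = record
      { partSize    = m
      ; part        = T
      ; 1≤partSize  = 1≤m
      ; s≤partSize  = s≤∣W∣ smallest
      ; part-⊆      = _≼_.⊆-pointwise T≼W
      ; ∣part∣≡    = ∣T∣≡m
      ; part-sparse = λ a≢b → ℚP.≤-trans (dI-≤-totalDensity T a≢b)
          (ℚP.≤-trans (_≼_.density-≤ T≼W) (totalDensity-≤ W 0≤δ W-sparse-≢))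
      }

-- Sparse H α γ ε t and SparseK H n α γ δ unfold to functions returning
-- SparseWitness H α γ ε t I X and SparseKWitness H n α γ δ I X P respectively.
SparseWitness : ∀ {N} → EOGraph N → (α γ ε : ℚ) (t : ℕ) → Interval → Subset N → Set
SparseWitness {N} H α γ ε t I X =
  Σ Interval λ I' → Σ (Fin t → Subset N) λ W →
    I' ⊆ᴵ I × α * ℕ→ℚ (size I) ≤ ℕ→ℚ (size I') ×
    (∀ i v → v ∈ W i → v ∈ X) ×
    (∀ i j → i ≢ j → Disjoint (W i) (W j)) ×
    (∀ i → γ * ℕ→ℚ ∣ X ∣ ≤ ℕ→ℚ ∣ W i ∣) ×
    (∀ i j → i Fin.< j → dI H I' (W i) (W j) < ε)

SparseKWitness : ∀ {N} → EOGraph N → (n : ℕ) (α γ δ : ℚ) → Interval → Subset N → (Fin n → Subset N) → Set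
SparseKWitness {N} H n α γ δ I X P =
  Σ Interval λ I' → Σ (Fin n) λ i → Σ (Fin n) λ i' → Σ (Subset N) λ W → Σ (Subset N) λ W' →
    I' ⊆ᴵ I × i ≢ i' × (∀ v → v ∈ W → v ∈ P i) × (∀ v → v ∈ W' → v ∈ P i') ×
    α * ℕ→ℚ (size I) ≤ ℕ→ℚ (size I') ×
    γ * ℕ→ℚ ∣ X ∣ ≤ ℕ→ℚ ∣ W ∣ × γ * ℕ→ℚ ∣ X ∣ ≤ ℕ→ℚ ∣ W' ∣ ×
    dI H I' W W' < δ

pairWitness : ∀ {N} {H : EOGraph N} {α γ ε I X} I' (A B : Subset N) →
  I' ⊆ᴵ I → α * ℕ→ℚ (size I) ≤ ℕ→ℚ (size I') → A ⊆ X → B ⊆ X → Disjoint A B →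
  γ * ℕ→ℚ ∣ X ∣ ≤ ℕ→ℚ ∣ A ∣ → γ * ℕ→ℚ ∣ X ∣ ≤ ℕ→ℚ ∣ B ∣ → dI H I' A B < ε →
  SparseWitness H α γ ε 2 I X
pairWitness {N} {H} {α} {γ} {ε} {I} {X} I' A B I'⊆I |I'|≥ A⊆X B⊆X A∩B≡∅ |A|≥ |B|≥ dAB<ε =
  I' , W , I'⊆I , |I'|≥ , W⊆X , W-disjoint , |W|≥ , W-sparse
  where
  W : Fin 2 → Subset N
  W zero    = A
  W (suc _) = B
  W⊆X : ∀ i v → v ∈ W i → v ∈ X
  W⊆X zero    _ = A⊆X
  W⊆X (suc _) _ = B⊆X
  W-disjoint : ∀ i j → i ≢ j → Disjoint (W i) (W j)
  W-disjoint zero          zero          0≢0 = ⊥-elim (0≢0 refl)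
  W-disjoint zero          (suc zero)    _   = A∩B≡∅
  W-disjoint (suc zero)    zero          _   = λ v v∈B v∈A → A∩B≡∅ v v∈A v∈B
  W-disjoint (suc zero)    (suc zero)    1≢1 = ⊥-elim (1≢1 refl)
  |W|≥ : ∀ i → γ * ℕ→ℚ ∣ X ∣ ≤ ℕ→ℚ ∣ W i ∣
  |W|≥ zero    = |A|≥
  |W|≥ (suc _) = |B|≥
  W-sparse : ∀ i j → i Fin.< j → dI H I' (W i) (W j) < ε
  W-sparse zero       (suc zero) _ = dAB<ε
  W-sparse (suc zero) (suc zero) (ℕ.s≤s ())

record BalancedWitness {N} (H : EOGraph N) (α γ ε : ℚ) (n : ℕ) (I : Interval) (X : Subset N) : Set where
  field
    interval       : Interval
    interval-⊆     : interval ⊆ᴵ I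
    interval-large : α * ℕ→ℚ (size I) ≤ ℕ→ℚ (size interval)
    partSize       : ℕ
    part           : Fin (ℕ.suc n) → Subset N
    part-⊆         : ∀ j → part j ⊆ X
    part-disjoint  : ∀ i j → i ≢ j → Disjoint (part i) (part j)
    ∣part∣≡        : ∀ j → ∣ part j ∣ ≡ partSize
    1≤partSize     : 1 ℕ.≤ partSize
    partSize-large : γ * ℕ→ℚ ∣ X ∣ ≤ ℕ→ℚ partSize
    part-sparse    : ∀ {a b} → a ≢ b → dI H interval (part a) (part b) ≤ ε

balance-witness : ∀ {N} (H : EOGraph N) → (∀ I A B → dI H I A B ≡ dI H I B A) → ∀ {n α γ δ I X} →
  1ℚ ≤ γ * ℕ→ℚ ∣ X ∣ → 0ℚ ≤ δ →
  SparseWitness H α γ δ (ℕ.suc n) I X → BalancedWitness H α γ (ℕ→ℚ (ℕ.suc n ℕ.* ℕ.suc n) * δ) n I X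
balance-witness H dI-comm {n} 1≤γX 0≤δ (I₁ , W , I₁⊆I , |I₁|≥ , W⊆X , W-disjoint , |W|≥ , W-sparse) = record
  { interval       = I₁
  ; interval-⊆     = I₁⊆I
  ; interval-large = |I₁|≥
  ; partSize       = partSize
  ; part           = part
  ; part-⊆         = λ j x∈ → W⊆X j _ (part-⊆ j x∈)
  ; part-disjoint  = λ i j i≢j v v∈i v∈j → W-disjoint i j i≢j v (part-⊆ i v∈i) (part-⊆ j v∈j)
  ; ∣part∣≡        = ∣part∣≡
  ; 1≤partSize     = 1≤partSize
  ; partSize-large = s≤partSize
  ; part-sparse    = part-sparse
  }
  where open Shrinking.Balanced (Shrinking.balance H I₁ (dI-comm I₁) n W 1≤γX 0≤δ |W|≥ W-sparse)

module _ {N q : ℕ} (G : ColoredEOComplete N q) (k n : ℕ) {α α' γ γ' δ δ' : ℚ}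
         (α'>0 : 0ℚ < α') (γ'>0 : 0ℚ < γ') (αα'>0 : 0ℚ < α * α') (γγ'>0 : 0ℚ < γ * γ') where

  pairWitness-colorLe-suc : SparseK (colorEq G (ℕ.suc k)) (ℕ.suc n) α' γ' δ' α'>0 γ'>0 →
    0ℚ ≤ δ' → δ' * ℕ→ℚ (ℕ.suc n) ≤ 1ℚ →
    ∀ {I X} → inv (α * α') αα'>0 ≤ ℕ→ℚ (size I) → inv (γ * γ') γγ'>0 ≤ ℕ→ℚ ∣ X ∣ →
    BalancedWitness (colorLe G k) α γ (ℕ→ℚ (ℕ.suc n ℕ.* ℕ.suc n) * δ) n I X →
    SparseWitness (colorLe G (ℕ.suc k)) (α * α') (γ * γ')
      (ℕ→ℚ (ℕ.suc n ℕ.* ℕ.suc n) * (inv γ' γ'>0 * inv γ' γ'>0) * δ + δ') 2 I X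
  pairWitness-colorLe-suc sparse-k+1 0≤δ' δ'n≤1 {I} {X} |I|≥ |X|≥ b =
    select (sparse-k+1 interval |interval|≥ X' |X'|≥ part part-disjoint (λ v → ∈-⋃ᶠ⁻ part) (λ i v → ⊆-⋃ᶠ part i)
                       (⋃ᶠ-share-≤ part 0≤δ' δ'n≤1 ∣part∣≡))
    where
    open BalancedWitness b
    X' = ⋃ᶠ part
    m = partSize
    ig = inv γ' γ'>0

    m≤∣X'∣ : m ℕ.≤ ∣ X' ∣
    m≤∣X'∣ = subst (ℕ._≤ ∣ X' ∣) (∣part∣≡ zero) (SubsetP.p⊆q⇒∣p∣≤∣q∣ (⊆-⋃ᶠ part zero))

    |interval|≥ : inv α' α'>0 ≤ ℕ→ℚ (size interval)
    |interval|≥ = inv-*-transfer {α} αα'>0 α'>0 |I|≥ interval-large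

    |X'|≥ : inv γ' γ'>0 ≤ ℕ→ℚ ∣ X' ∣
    |X'|≥ = inv-*-transfer {γ} γγ'>0 γ'>0 |X|≥ (ℚP.≤-trans partSize-large (ℕ→ℚ-mono-≤ m≤∣X'∣))

    γ'm≤ : ∀ Y → γ' * ℕ→ℚ ∣ X' ∣ ≤ ℕ→ℚ ∣ Y ∣ → γ' * ℕ→ℚ m ≤ ℕ→ℚ ∣ Y ∣
    γ'm≤ Y = ℚP.≤-trans (*-monoˡ-≤ γ' (ℚP.<⇒≤ γ'>0) (ℕ→ℚ-mono-≤ m≤∣X'∣))

    γγ'∣X∣≤ : ∀ Y → γ' * ℕ→ℚ ∣ X' ∣ ≤ ℕ→ℚ ∣ Y ∣ → (γ * γ') * ℕ→ℚ ∣ X ∣ ≤ ℕ→ℚ ∣ Y ∣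
    γγ'∣X∣≤ Y |Y|≥ = ℚP.≤-trans (*-rescale-≤ {γ} (ℚP.<⇒≤ γ'>0) partSize-large) (γ'm≤ Y |Y|≥)

    γ'∣part∣≤ : ∀ Y j → γ' * ℕ→ℚ ∣ X' ∣ ≤ ℕ→ℚ ∣ Y ∣ → γ' * ℕ→ℚ ∣ part j ∣ ≤ ℕ→ℚ ∣ Y ∣
    γ'∣part∣≤ Y j |Y|≥ = subst (λ a → γ' * ℕ→ℚ a ≤ ℕ→ℚ ∣ Y ∣) (sym (∣part∣≡ j)) (γ'm≤ Y |Y|≥)

    1≤∣part∣ : ∀ j → 1 ℕ.≤ ∣ part j ∣
    1≤∣part∣ j = subst (1 ℕ.≤_) (sym (∣part∣≡ j)) 1≤partSize

    select : SparseKWitness (colorEq G (ℕ.suc k)) (ℕ.suc n) α' γ' δ' interval X' part →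
      SparseWitness (colorLe G (ℕ.suc k)) (α * α') (γ * γ') (ℕ→ℚ (ℕ.suc n ℕ.* ℕ.suc n) * (ig * ig) * δ + δ') 2 I X
    select (I₂ , i , i' , A , B , I₂⊆ , i≢i' , A⊆ , B⊆ , |I₂|≥ , |A|≥ , |B|≥ , d=k+1<δ') =
      pairWitness {H = colorLe G (ℕ.suc k)} {α * α'} {γ * γ'} {I = I} {X} I₂ A B (λ x → interval-⊆ x ∘ I₂⊆ x)
        (ℚP.≤-trans (*-rescale-≤ {α} (ℚP.<⇒≤ α'>0) interval-large) |I₂|≥)
        (λ x∈ → part-⊆ i (A⊆ _ x∈)) (λ x∈ → part-⊆ i' (B⊆ _ x∈))
        (λ v v∈A v∈B → part-disjoint i i' i≢i' v (A⊆ v v∈A) (B⊆ v v∈B))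
        (γγ'∣X∣≤ A |A|≥) (γγ'∣X∣≤ B |B|≥)
        (subst (_< _) (sym (dI-colorLe-suc G k I₂ A B)) (ℚP.+-mono-≤-< d≤k d=k+1<δ'))
      where
      open ℚP.≤-Reasoning
      regroup : ∀ i e d → (i * i) * (e * d) ≡ e * (i * i) * d
      regroup = solve-∀ ℚ-ring
      d≤k : dI (colorLe G k) I₂ A B ≤ ℕ→ℚ (ℕ.suc n ℕ.* ℕ.suc n) * (ig * ig) * δ
      d≤k = begin
        dI (colorLe G k) I₂ A B
          ≤⟨ dI-⊆-≤ (colorLe G k) γ'>0 I₂⊆ (A⊆ _) (B⊆ _) (1≤∣part∣ i) (1≤∣part∣ i')
               (γ'∣part∣≤ A i |A|≥) (γ'∣part∣≤ B i' |B|≥) ⟩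
        (ig * ig) * dI (colorLe G k) interval (part i) (part i')
          ≤⟨ *-monoˡ-≤ (ig * ig) (0≤* (0≤inv γ'>0) (0≤inv γ'>0)) (part-sparse i≢i') ⟩
        (ig * ig) * (ℕ→ℚ (ℕ.suc n ℕ.* ℕ.suc n) * δ)
          ≡⟨ regroup ig (ℕ→ℚ (ℕ.suc n ℕ.* ℕ.suc n)) δ ⟩
        ℕ→ℚ (ℕ.suc n ℕ.* ℕ.suc n) * (ig * ig) * δ ∎

lemma10 : (n : ℕ) .{{_ : NonZero n}} → (q k : ℕ) → 1 ℕ.≤ k → k ℕ.< q →
    (α α' γ γ' δ δ' : ℚ) →
    (α>0 : 0ℚ < α) → α < 1ℚ → (α'>0 : 0ℚ < α') → α' < 1ℚ →
    (γ>0 : 0ℚ < γ) → γ < 1ℚ → (γ'>0 : 0ℚ < γ') → γ' < 1ℚ →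
    0ℚ < δ → δ < 1ℚ → 0ℚ < δ' → δ' < (+ 1) / n →
    (N : ℕ) (G : ColoredEOComplete N q) →
    Sparse (colorLe G k) α γ δ n α>0 γ>0 →
    SparseK (colorEq G (ℕ.suc k)) n α' γ' δ' α'>0 γ'>0 →
    (αα'>0 : 0ℚ < α * α') → (γγ'>0 : 0ℚ < γ * γ') →
    Sparse (colorLe G (ℕ.suc k)) (α * α') (γ * γ')
      (ℕ→ℚ (n ℕ.* n) * (inv γ' γ'>0 * inv γ' γ'>0) * δ + δ') 2 αα'>0 γγ'>0
lemma10 (ℕ.suc n) q k _ _ α α' γ γ' δ δ' α>0 _ α'>0 α'<1 γ>0 _ γ'>0 γ'<1 δ>0 _ δ'>0 δ'<1/n N G
        sparse-k sparse-k+1 αα'>0 γγ'>0 I |I|≥ X |X|≥ =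
  pairWitness-colorLe-suc G k n {α = α} {γ = γ} α'>0 γ'>0 αα'>0 γγ'>0 sparse-k+1 (ℚP.<⇒≤ δ'>0) δ'n≤1 |I|≥ |X|≥
    (balance-witness (colorLe G k) (dI-colorLe-comm G k) (inv≤⇒1≤* γ>0 |X|≥γ) (ℚP.<⇒≤ δ>0)
      (sparse-k I |I|≥α X |X|≥γ))
  where
  |I|≥α : inv α α>0 ≤ ℕ→ℚ (size I)
  |I|≥α = inv-*-weakenˡ {α} {α'} αα'>0 α>0 (ℚP.<⇒≤ α'>0) (ℚP.<⇒≤ α'<1) (0≤ℕ→ℚ (size I)) |I|≥
  |X|≥γ : inv γ γ>0 ≤ ℕ→ℚ ∣ X ∣
  |X|≥γ = inv-*-weakenˡ {γ} {γ'} γγ'>0 γ>0 (ℚP.<⇒≤ γ'>0) (ℚP.<⇒≤ γ'<1) (0≤ℕ→ℚ ∣ X ∣) |X|≥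
  δ'n≤1 : δ' * ℕ→ℚ (ℕ.suc n) ≤ 1ℚ
  δ'n≤1 = ℚP.≤-trans (*-monoʳ-≤ (ℕ→ℚ (ℕ.suc n)) (0≤ℕ→ℚ (ℕ.suc n)) (ℚP.<⇒≤ δ'<1/n))
                     (ℚP.≤-reflexive (recip-inverseˡ n))
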